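{- Let $n\ge1$ and let $M'_n$ be the $2^{n-1}\times 2^{n-1}$ matrix with rows and columns indexed by subsets of $\{1,\dots,n-1\}$ (in a fixed common order) and $(M'_n)_{I,J}=a_{n,I,J}$. Then the characteristic polynomials of $M'_n$ and $M_n$ coincide up to a factor which is a power of the variable, and for every simple $n$-braid $y$ with $D_L(y)=J$ and every $d\ge1$, $$b_{n,d}(y)=\big((1,1,\dots,1)\,M_n'^{\,d-1}\big)_J.$$
   Context: $B_n^+$ is the monoid generated by $\sigma_1,\dots,\sigma_{n-1}$ subject to $\sigma_i\sigma_j=\sigma_j\sigma_i$ for $|i-j|\ge 2$ and $\sigma_i\sigma_j\sigma_i=\sigma_j\sigma_i\sigma_j$ for $|i-j|=1$. Define $\Delta_1=1$, $\Delta_n=\sigma_1\cdots\sigma_{n-1}\Delta_{n-1}$; a positive $n$-braid is simple if it left-divides $\Delta_n$. For simple $x$, $D_L(x)$ (resp. $D_R(x)$) is the set of $i\in\{1,\dots,n-1\}$ with $\sigma_i$ a left (resp. right) divisor of $x$. For $I,J\subseteq\{1,\dots,n-1\}$, $a_{n,I,J}$ is the number of simple $n$-braids $x$ with $D_L(x)=I$ and $D_R(x)\supseteq J$. A sequence $(x_1,\dots,x_d)$ of simple $n$-braids is normal if $x_k$ is the left gcd of $\Delta_n$ and $x_k\cdots x_d$ for each $k$; equivalently $D_R(x_k)\supseteq D_L(x_{k+1})$ for all $k<d$. $b_{n,d}(y)$ is the number of positive $n$-braids of degree at most $d$ whose $d$th normal factor is $y$, i.e. the number of normal sequences $(x_1,\dots,x_{d-1},y)$.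 $M_n$ is the $n!\times n!$ matrix indexed by simple $n$-braids with $(M_n)_{x,y}=1$ if $(x,y)$ is normal and $0$ otherwise. -}

module Defs where

open import Data.Nat using (ℕ; zero; suc; _<_; _+_; _*_; _≤_)
open import Data.Integer as ℤ using (ℤ; +_)
open import Data.Fin using (Fin; zero; suc; toℕ; punchIn; _≟_)
open import Data.Fin.Subset using (Subset; _∈_)
open import Data.List using (List; []; _∷_; _++_; upTo; map; _∷ʳ_; [_])
open import Data.List.Relation.Unary.All using (All)
open import Data.Vec using (Vec; toList)
import Data.Vec.Relation.Unary.All as VAll
open import Data.Vec.Relation.Binary.Pointwise.Inductive using (Pointwise)
open import Data.Product using (Σ; ∃; _×_; _,_; proj₁)
open import Data.Unit using (⊤)
open import Data.Bool using (if_then_else_)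
open import Relation.Nullary using (¬_; does)
open import Relation.Binary.PropositionalEquality using (_≡_)
open import Relation.Binary.Construct.Closure.Equivalence using (EqClosure)

-- Positive braid words.  The letter i : ℕ stands for the generator
-- σ_(i+1).  An n-braid word uses only σ_1,…,σ_(n-1), i.e. letters i
-- with i < n-1 (equivalently suc i < n).

IsWord : ℕ → List ℕ → Set
IsWord n w = All (λ i → suc i < n) w

data Step : List ℕ → List ℕ → Set where
  comm  : ∀ u v i j → 2 + i ≤ j →
          Step (u ++ i ∷ j ∷ v) (u ++ j ∷ i ∷ v)
  braid : ∀ u v i →
          Step (u ++ i ∷ suc i ∷ i ∷ v) (u ++ suc i ∷ i ∷ suc i ∷ v)

_≈_ : List ℕ → List ℕ → Set
_≈_ = EqClosure Step

-- Δ_n : Δ_1 = 1, Δ_n = σ_1 ⋯ σ_(n-1) Δ_(n-1)  (Δ_0 := 1, unused)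
Δw : ℕ → List ℕ
Δw zero    = []
Δw (suc k) = upTo k ++ Δw k

LDiv : ℕ → List ℕ → List ℕ → Set
LDiv n x y = Σ (List ℕ) λ z → IsWord n z × ((x ++ z) ≈ y)

RDiv : ℕ → List ℕ → List ℕ → Set
RDiv n x y = Σ (List ℕ) λ z → IsWord n z × ((z ++ x) ≈ y)

Simple : ℕ → List ℕ → Set
Simple n x = IsWord n x × LDiv n x (Δw n)

-- index i : Fin (n-1) stands for σ_(toℕ i + 1)
σ : ∀ {m} → Fin m → List ℕ
σ i = [ toℕ i ]

DL≡ : (n : ℕ) → List ℕ → Subset (n Data.Nat.∸ 1) → Set
DL≡ n x I = ∀ i → (i ∈ I → LDiv n (σ i) x) × (LDiv n (σ i) x → i ∈ I)

DR⊇ : (n : ℕ) → List ℕ → Subset (n Data.Nat.∸ 1) → Set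
DR⊇ n x J = ∀ i → i ∈ J → RDiv n (σ i) x

NormalPair : ℕ → List ℕ → List ℕ → Set
NormalPair n x y = ∀ (i : Fin (n Data.Nat.∸ 1)) → LDiv n (σ i) y → RDiv n (σ i) x

NormalSeq : ℕ → List (List ℕ) → Set
NormalSeq n []           = ⊤
NormalSeq n (x ∷ [])     = ⊤
NormalSeq n (x ∷ y ∷ r)  = NormalPair n x y × NormalSeq n (y ∷ r)

-- "The number of ∼-classes of elements satisfying P is k":
-- an enumeration of k pairwise inequivalent elements satisfying P
-- such that every element satisfying P is equivalent to one of them.

HasCount : {A : Set} → (A → A → Set) → (A → Set) → ℕ → Set
HasCount {A} _∼_ P k =
  Σ (Fin k → A) λ e →
    (∀ a → P (e a)) ×
    (∀ a b → e a ∼ e b → a ≡ b) ×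
    (∀ x → P x → ∃ λ a → x ∼ e a)

IsA : (n : ℕ) → Subset (n Data.Nat.∸ 1) → Subset (n Data.Nat.∸ 1) → ℕ → Set
IsA n I J = HasCount _≈_ (λ x → Simple n x × DL≡ n x I × DR⊇ n x J)

IsB : (n d : ℕ) → List ℕ → ℕ → Set
IsB n d y = HasCount (Pointwise _≈_)
  (λ (xs : Vec (List ℕ) (d Data.Nat.∸ 1)) →
     VAll.All (Simple n) xs × NormalSeq n (toList xs ∷ʳ y))

Σℕ : (m : ℕ) → (Fin m → ℕ) → ℕ
Σℕ zero    f = 0
Σℕ (suc m) f = f zero + Σℕ m (λ i → f (suc i))

_ᵥ*_ : ∀ {m} → (Fin m → ℕ) → (Fin m → Fin m → ℕ) → (Fin m → ℕ)
_ᵥ*_ {m} v M b = Σℕ m (λ a → v a * M a b)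

vecPow : ∀ {m} → (Fin m → ℕ) → (Fin m → Fin m → ℕ) → ℕ → (Fin m → ℕ)
vecPow v M zero    = v
vecPow v M (suc k) = vecPow v M k ᵥ* M

ones : ∀ {m} → Fin m → ℕ
ones _ = 1

-- Polynomials over ℤ as coefficient lists (constant term first),
-- compared coefficientwise (trailing zeros irrelevant).

Poly : Set
Poly = List ℤ

coeff : Poly → ℕ → ℤ
coeff []      _       = + 0
coeff (a ∷ p) zero    = a
coeff (a ∷ p) (suc k) = coeff p k

_≋_ : Poly → Poly → Set
p ≋ q = ∀ k → coeff p k ≡ coeff q k

_+ₚ_ : Poly → Poly → Poly
[]      +ₚ q       = q
(a ∷ p) +ₚ []      = a ∷ p
(a ∷ p) +ₚ (b ∷ q) = (a ℤ.+ b) ∷ (p +ₚ q)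

-ₚ_ : Poly → Poly
-ₚ p = map ℤ.-_ p

_*ₚ_ : Poly → Poly → Poly
[]      *ₚ q = []
(a ∷ p) *ₚ q = map (a ℤ.*_) q +ₚ (+ 0 ∷ (p *ₚ q))

oneₚ : Poly
oneₚ = + 1 ∷ []

Xₚ : Poly
Xₚ = + 0 ∷ + 1 ∷ []

_^ₚ_ : Poly → ℕ → Poly
p ^ₚ zero  = oneₚ
p ^ₚ suc k = p *ₚ (p ^ₚ k)

Σₚ : (m : ℕ) → (Fin m → Poly) → Poly
Σₚ zero    f = []
Σₚ (suc m) f = f zero +ₚ Σₚ m (λ i → f (suc i))

sgn : ℕ → Poly → Poly
sgn zero    p = p
sgn (suc k) p = -ₚ (sgn k p)

det : (m : ℕ) → (Fin m → Fin m → Poly) → Poly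
det zero    M = oneₚ
det (suc m) M = Σₚ (suc m) λ j →
  sgn (toℕ j) (M zero j *ₚ det m (λ a b → M (suc a) (punchIn j b)))

charPoly : (m : ℕ) → (Fin m → Fin m → ℕ) → Poly
charPoly m M = det m λ i j →
  (if does (i ≟ j) then Xₚ else []) +ₚ (-ₚ (+ (M i j) ∷ []))

{-# OPTIONS --safe #-}
-- Let U (simple braids × subsets) and V (subsets × simple braids) be the 0/1 matrices
-- U x J = [D_R(x) ⊇ J] and V J y = [D_L(y) = J].  Then (U V) x y = [D_R(x) ⊇ D_L(y)] is M_n, while
-- (V U) J I counts the simple braids with D_L = J and D_R ⊇ I, so it is M'_n.  Sylvester's identity
-- t^m det(t − U V) = t^N det(t − V U) (N = n!, m = 2^(n-1)) makes the characteristic polynomials differ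
-- by a power of t.  For the second claim, the normal sequences ending in y are the normal sequences
-- ending in some simple x with D_R(x) ⊇ D_L(y) = J, followed by y.  Grouping the x by I = D_L(x), with
-- a_{n,I,J} choices of x for each I, induction on d gives b_{n,d+1}(y) = Σ_I b_{n,d}(I) a_{n,I,J},
-- where b_{n,d}(I) is the common value of b_{n,d} on the simple braids with D_L = I.
module Submission where

open import Algebra.Bundles using (CommutativeRing)
open import Data.List.Base using (List)
open import Data.List.Membership.Propositional using () renaming (_∈_ to _∈ₗ_)
open import Data.List.Relation.Unary.Any using (Any)
open import Data.Nat.Base using (ℕ; _≤_; _<_; z≤n; s≤s)
open import Data.Product.Base using (∃; proj₁)
open import Level using (_⊔_)
open import Relation.Binary.Definitions using (DecidableEquality)
open import Relation.Binary.PropositionalEquality using (_≡_)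
open import Relation.Nullary using (¬_; Dec; yes; no)
open import Relation.Nullary.Negation using (contradiction)

NoTwoTorsion : ∀ {c ℓ} → CommutativeRing c ℓ → Set (c ⊔ ℓ)
NoTwoTorsion R = ∀ x → x + x ≈ 0# → x ≈ 0#
  where open CommutativeRing R

module Determinant {c ℓ} (R : CommutativeRing c ℓ) (noTwoTorsion : NoTwoTorsion R) where

  open import Algebra.Bundles using (Semiring)
  import Algebra.Properties.CommutativeSemigroup as CommutativeSemigroupProperties
  import Algebra.Properties.Ring as RingProperties
  import Algebra.Properties.Semiring.Sum as SumProperties
  open import Data.Bool.Base using (true; false; if_then_else_)
  open import Data.Fin.Base using (Fin; zero; suc; toℕ; punchIn; punchOut; _↑ˡ_; _↑ʳ_; splitAt; fromℕ<)
  open import Data.Fin.Properties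
    using (punchInᵢ≢i; punchIn-punchOut; toℕ-↑ˡ; toℕ-fromℕ<; toℕ<n; toℕ-injective; splitAt⁻¹-↑ˡ; splitAt⁻¹-↑ʳ)
    renaming (_≟_ to _≟ᶠ_)
  open import Data.Nat.Base as ℕ using (zero; suc)
  import Data.Nat.Properties as ℕ
  open import Data.Product.Base using (_,_)
  open import Data.Sum.Base using (_⊎_; inj₁; inj₂)
  open import Data.Vec.Functional using (updateAt; _++_)
  open import Data.Vec.Functional.Properties
    using (updateAt-updates; updateAt-minimal; updateAt-id-local; updateAt-commutes; map-updateAt-local; lookup-++ˡ; lookup-++ʳ)
  open import Function.Base using (_∘_; const)
  open import Relation.Binary.PropositionalEquality as ≡ using (_≢_)
  open import Relation.Nullary using (does)
  open import Relation.Nullary.Decidable using (dec-true; dec-false)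

  open CommutativeRing R renaming (Carrier to A) hiding (zero)
  open RingProperties ring using (-‿distribˡ-*; -‿distribʳ-*; -0#≈0#; -‿involutive; -‿+-comm; +-inverseʳ-unique)
  open SumProperties semiring
    using (sum; sum-syntax; sum-cong-≋; sum-cong-≗; sum-replicate-zero; ∑-distrib-+; ∑-comm; sum-remove; *-distribˡ-sum)
  module +-Comm = CommutativeSemigroupProperties +-commutativeSemigroup
  module *-Comm = CommutativeSemigroupProperties *-commutativeSemigroup
  open import Relation.Binary.Reasoning.Setoid setoid
  open import Algebra.Properties.Monoid.Sum *-monoid using ()
    renaming ( sum to product; sum-cong-≋ to product-cong
             ; sum-replicate to product-replicate; sum-replicate-zero to product-replicate-1#)
  open import Algebra.Definitions.RawSemiring (Semiring.rawSemiring semiring) using (_^_)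

  sum-zero : ∀ {n} (f : Fin n → A) → (∀ i → f i ≈ 0#) → sum f ≈ 0#
  sum-zero {n} f f≈0 = trans (sum-cong-≋ f≈0) (sum-replicate-zero n)

  -‿distrib-sum : ∀ {n} (f : Fin n → A) → - sum f ≈ ∑[ i < n ] (- f i)
  -‿distrib-sum {zero}  f = -0#≈0#
  -‿distrib-sum {suc n} f = trans (sym (-‿+-comm _ _)) (+-congˡ (-‿distrib-sum (f ∘ suc)))

  sum-linear : ∀ {n} x (f g : Fin n → A) → ∑[ i < n ] (x * f i + g i) ≈ x * sum f + sum g
  sum-linear x f g = trans (∑-distrib-+ _ g) (+-congʳ (sym (*-distribˡ-sum x f)))

  sum-splitAt : ∀ N m (f : Fin (N ℕ.+ m) → A) →
    sum f ≈ ∑[ i < N ] f (i ↑ˡ m) + ∑[ k < m ] f (N ↑ʳ k)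
  sum-splitAt zero    m f = sym (+-identityˡ _)
  sum-splitAt (suc N) m f = trans (+-congˡ (sum-splitAt N m (f ∘ suc))) (sym (+-assoc _ _ _))

  sign : ℕ → A → A
  sign zero    x = x
  sign (suc k) x = - sign k x

  sign-cong : ∀ k {x y} → x ≈ y → sign k x ≈ sign k y
  sign-cong zero    x≈y = x≈y
  sign-cong (suc k) x≈y = -‿cong (sign-cong k x≈y)

  sign-+ : ∀ k x y → sign k (x + y) ≈ sign k x + sign k y
  sign-+ zero    x y = refl
  sign-+ (suc k) x y = trans (-‿cong (sign-+ k x y)) (sym (-‿+-comm _ _))

  sign-*ˡ : ∀ k x y → sign k (x * y) ≈ x * sign k y
  sign-*ˡ zero    x y = refl
  sign-*ˡ (suc k) x y = trans (-‿cong (sign-*ˡ k x y)) (-‿distribʳ-* _ _)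

  sign-linear : ∀ k x y z → sign k (x * y + z) ≈ x * sign k y + sign k z
  sign-linear k x y z = trans (sign-+ k _ z) (+-congʳ (sign-*ˡ k x y))

  sign-0# : ∀ k → sign k 0# ≈ 0#
  sign-0# zero    = refl
  sign-0# (suc k) = trans (-‿cong (sign-0# k)) -0#≈0#

  sign-neg : ∀ k x → sign k (- x) ≈ - sign k x
  sign-neg zero    x = refl
  sign-neg (suc k) x = -‿cong (sign-neg k x)

  sign-sum : ∀ k {n} (f : Fin n → A) → sign k (sum f) ≈ ∑[ i < n ] sign k (f i)
  sign-sum k {zero}  f = sign-0# k
  sign-sum k {suc n} f = trans (sign-+ k _ _) (+-congˡ (sign-sum k (f ∘ suc)))

  sign-+ℕ : ∀ i j x → sign (i ℕ.+ j) x ≡ sign i (sign j x)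
  sign-+ℕ zero    j x = ≡.refl
  sign-+ℕ (suc i) j x = ≡.cong -_ (sign-+ℕ i j x)

  Matrix : ℕ → Set c
  Matrix n = Fin n → Fin n → A

  minor : ∀ {n} → Fin (suc n) → Matrix (suc n) → Matrix n
  minor j M a b = M (suc a) (punchIn j b)

  det : ∀ n → Matrix n → A
  det zero    M = 1#
  det (suc n) M = ∑[ j < suc n ] sign (toℕ j) (M zero j * det n (minor j M))

  cofactorTerm : ∀ n → Matrix (suc n) → Fin (suc n) → A
  cofactorTerm n M j = sign (toℕ j) (M zero j * det n (minor j M))

  det-cong : ∀ n {M N : Matrix n} → (∀ a b → M a b ≈ N a b) → det n M ≈ det n N
  det-cong zero    M≈N = refl
  det-cong (suc n) M≈N = sum-cong-≋ {suc n} λ j → sign-cong (toℕ j)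
    (*-cong (M≈N zero j) (det-cong n λ a b → M≈N (suc a) (punchIn j b)))

  det-termwise-linear : ∀ n (M P Q : Matrix (suc n)) x →
    (∀ j → M zero j * det n (minor j M) ≈ x * (P zero j * det n (minor j P)) + Q zero j * det n (minor j Q)) →
    det (suc n) M ≈ x * det (suc n) P + det (suc n) Q
  det-termwise-linear n M P Q x termwise = trans
    (sum-cong-≋ {suc n} λ j → trans (sign-cong (toℕ j) (termwise j)) (sign-linear (toℕ j) x _ _))
    (sum-linear x (cofactorTerm n P) (cofactorTerm n Q))

  setRow : ∀ {n} → Matrix n → Fin n → (Fin n → A) → Matrix n
  setRow M r u = updateAt M r (const u)

  setRow-≡ : ∀ {n} (M : Matrix n) r u → setRow M r u r ≡ u
  setRow-≡ M r u = updateAt-updates r M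

  setRow-≢ : ∀ {n} (M : Matrix n) {r a} u → a ≢ r → setRow M r u a ≡ M a
  setRow-≢ M {r} {a} u a≢r = updateAt-minimal a r M a≢r

  setRow-cong : ∀ {n} (M : Matrix n) r {u v : Fin n → A} → (∀ b → u b ≈ v b) →
    ∀ a b → setRow M r u a b ≈ setRow M r v a b
  setRow-cong M r {u} {v} u≈v a b with a ≟ᶠ r
  ... | yes ≡.refl = begin
    setRow M a u a b ≡⟨ ≡.cong-app (setRow-≡ M a u) b ⟩
    u b              ≈⟨ u≈v b ⟩
    v b              ≡⟨ ≡.cong-app (setRow-≡ M a v) b ⟨
    setRow M a v a b ∎
  ... | no a≢r = reflexive (≡.cong-app (≡.trans (setRow-≢ M u a≢r) (≡.sym (setRow-≢ M v a≢r))) b)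

  det-setRow-self : ∀ n (M : Matrix n) r → det n (setRow M r (M r)) ≈ det n M
  det-setRow-self n M r = det-cong n λ a b → reflexive (≡.cong-app (updateAt-id-local r M ≡.refl a) b)

  minor-setRow : ∀ {n} j (M : Matrix (suc n)) r u a b →
    minor j (setRow M (suc r) u) a b ≡ setRow (minor j M) r (u ∘ punchIn j) a b
  minor-setRow j M r u a = ≡.cong-app (map-updateAt-local {f = _∘ punchIn j} (M ∘ suc) r ≡.refl a)

  det-minor-setRow : ∀ n j (M : Matrix (suc n)) r u →
    det n (minor j (setRow M (suc r) u)) ≈ det n (setRow (minor j M) r (u ∘ punchIn j))
  det-minor-setRow n j M r u = det-cong n λ a b → reflexive (minor-setRow j M r u a b)

  det-linear : ∀ n (M : Matrix n) r x (u v : Fin n → A) →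
    det n (setRow M r (λ b → x * u b + v b)) ≈ x * det n (setRow M r u) + det n (setRow M r v)
  det-linear (suc n) M zero x u v =
    det-termwise-linear n (setRow M zero _) (setRow M zero u) (setRow M zero v) x λ j →
      trans (distribʳ _ _ _) (+-congʳ (*-assoc _ _ _))
  det-linear (suc n) M (suc r) x u v =
    det-termwise-linear n (setRow M (suc r) _) (setRow M (suc r) u) (setRow M (suc r) v) x λ j → begin
      M zero j * det n (minor j (setRow M (suc r) _))
        ≈⟨ *-congˡ (trans (det-minor-setRow n j M r _) (det-linear n (minor j M) r x _ _)) ⟩
      M zero j * (x * det n (setRow (minor j M) r (u ∘ punchIn j)) + det n (setRow (minor j M) r (v ∘ punchIn j)))
        ≈⟨ trans (distribˡ _ _ _) (+-congʳ (*-Comm.x∙yz≈y∙xz _ _ _)) ⟩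
      x * (M zero j * det n (setRow (minor j M) r (u ∘ punchIn j))) + M zero j * det n (setRow (minor j M) r (v ∘ punchIn j))
        ≈⟨ sym (+-cong (*-congˡ (*-congˡ (det-minor-setRow n j M r u))) (*-congˡ (det-minor-setRow n j M r v))) ⟩
      x * (M zero j * det n (minor j (setRow M (suc r) u))) + M zero j * det n (minor j (setRow M (suc r) v)) ∎

  det-additive : ∀ n (M : Matrix n) r (u v : Fin n → A) →
    det n (setRow M r (λ b → u b + v b)) ≈ det n (setRow M r u) + det n (setRow M r v)
  det-additive n M r u v = begin
    det n (setRow M r (λ b → u b + v b))
      ≈⟨ det-cong n (setRow-cong M r λ b → +-congʳ (sym (*-identityˡ _))) ⟩
    det n (setRow M r (λ b → 1# * u b + v b))        ≈⟨ det-linear n M r 1# u v ⟩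
    1# * det n (setRow M r u) + det n (setRow M r v) ≈⟨ +-congʳ (*-identityˡ _) ⟩
    det n (setRow M r u) + det n (setRow M r v)      ∎

  det-zeroRow : ∀ n (M : Matrix n) r → det n (setRow M r (λ _ → 0#)) ≈ 0#
  det-zeroRow n M r = begin
    D                                          ≈⟨ det-cong n (setRow-cong M r λ _ → 0≈-1*0+0) ⟩
    det n (setRow M r (λ _ → - 1# * 0# + 0#))  ≈⟨ det-linear n M r (- 1#) _ _ ⟩
    - 1# * D + D                               ≈⟨ +-congʳ (trans (sym (-‿distribˡ-* 1# D)) (-‿cong (*-identityˡ D))) ⟩
    - D + D                                    ≈⟨ -‿inverseˡ D ⟩
    0#                                         ∎
    where
    D : A
    D = det n (setRow M r (λ _ → 0#))
    0≈-1*0+0 : 0# ≈ - 1# * 0# + 0#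
    0≈-1*0+0 = sym (trans (+-identityʳ _) (zeroʳ _))

  det-setRow-sum : ∀ n (M : Matrix n) r {k} (x : Fin k → A) (W : Fin k → Fin n → A) →
    det n (setRow M r (λ b → ∑[ s < k ] (x s * W s b))) ≈ ∑[ s < k ] (x s * det n (setRow M r (W s)))
  det-setRow-sum n M r {zero}  x W = det-zeroRow n M r
  det-setRow-sum n M r {suc k} x W = trans (det-linear n M r (x zero) (W zero) _)
    (+-congˡ (det-setRow-sum n M r (x ∘ suc) (W ∘ suc)))

  -- Alternation

  -- A total punchOut: punchIn a (punchOut′ a b) ≡ b whenever a ≢ b.
  punchOut′ : ∀ {n} → Fin (suc (suc n)) → Fin (suc (suc n)) → Fin (suc n)
  punchOut′         zero    zero    = zero
  punchOut′         zero    (suc b) = b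
  punchOut′         (suc a) zero    = zero
  punchOut′ {zero}  (suc a) (suc b) = zero
  punchOut′ {suc n} (suc a) (suc b) = suc (punchOut′ a b)

  punchOut′-punchIn : ∀ {n} (a : Fin (suc (suc n))) k → punchOut′ a (punchIn a k) ≡ k
  punchOut′-punchIn         zero    k       = ≡.refl
  punchOut′-punchIn         (suc a) zero    = ≡.refl
  punchOut′-punchIn {suc n} (suc a) (suc k) = ≡.cong suc (punchOut′-punchIn a k)

  punchIn-punchIn-comm : ∀ {n} (a b : Fin (suc (suc n))) → a ≢ b → ∀ y →
    punchIn a (punchIn (punchOut′ a b) y) ≡ punchIn b (punchIn (punchOut′ b a) y)
  punchIn-punchIn-comm         zero    zero    a≢b y       = contradiction ≡.refl a≢b
  punchIn-punchIn-comm         zero    (suc b) a≢b y       = ≡.refl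
  punchIn-punchIn-comm         (suc a) zero    a≢b y       = ≡.refl
  punchIn-punchIn-comm {suc n} (suc a) (suc b) a≢b zero    = ≡.refl
  punchIn-punchIn-comm {suc n} (suc a) (suc b) a≢b (suc y) =
    ≡.cong suc (punchIn-punchIn-comm a b (a≢b ∘ ≡.cong suc) y)
  punchIn-punchIn-comm {zero}  (suc zero) (suc zero) a≢b y = contradiction ≡.refl a≢b

  +-suc-both : ∀ x y {p q} → x ℕ.+ p ≡ suc (y ℕ.+ q) → x ℕ.+ suc p ≡ suc (y ℕ.+ suc q)
  +-suc-both x y {p} {q} eq = ≡.trans (ℕ.+-suc x p) (≡.cong suc (≡.trans eq (≡.sym (ℕ.+-suc y q))))

  punchOut′-sum-adjacent : ∀ {n} (a b : Fin (suc (suc n))) → a ≢ b →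
    (toℕ a ℕ.+ toℕ (punchOut′ a b) ≡ suc (toℕ b ℕ.+ toℕ (punchOut′ b a))) ⊎
    (toℕ b ℕ.+ toℕ (punchOut′ b a) ≡ suc (toℕ a ℕ.+ toℕ (punchOut′ a b)))
  punchOut′-sum-adjacent         zero       zero       a≢b = contradiction ≡.refl a≢b
  punchOut′-sum-adjacent         zero       (suc b)    a≢b = inj₂ (≡.cong suc (ℕ.+-identityʳ (toℕ b)))
  punchOut′-sum-adjacent         (suc a)    zero       a≢b = inj₁ (≡.cong suc (ℕ.+-identityʳ (toℕ a)))
  punchOut′-sum-adjacent {zero}  (suc zero) (suc zero) a≢b = contradiction ≡.refl a≢b
  punchOut′-sum-adjacent {suc n} (suc a)    (suc b)    a≢b
    with punchOut′-sum-adjacent a b (a≢b ∘ ≡.cong suc)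
  ... | inj₁ eq = inj₁ (≡.cong suc (+-suc-both (toℕ a) (toℕ b) eq))
  ... | inj₂ eq = inj₂ (≡.cong suc (+-suc-both (toℕ b) (toℕ a) eq))

  sign-adjacent : ∀ i j {x y} → x ≈ y → i ≡ suc j ⊎ j ≡ suc i → sign i x ≈ - sign j y
  sign-adjacent i j {x} {y} x≈y (inj₁ ≡.refl) = -‿cong (sign-cong j x≈y)
  sign-adjacent i j {x} {y} x≈y (inj₂ ≡.refl) = trans (sym (-‿involutive _)) (-‿cong (-‿cong (sign-cong i x≈y)))

  sum-removeAt : ∀ {n} (t : Fin (suc n) → A) i → ∑[ k < n ] t (punchIn i k) ≈ sum t - t i
  sum-removeAt t i = begin
    sum (t ∘ punchIn i)                ≈⟨ sym (+-identityʳ _) ⟩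
    sum (t ∘ punchIn i) + 0#           ≈⟨ +-congˡ (sym (-‿inverseʳ (t i))) ⟩
    sum (t ∘ punchIn i) + (t i - t i)  ≈⟨ +-Comm.x∙yz≈y∙xz _ _ _ ⟩
    t i + (sum (t ∘ punchIn i) - t i)  ≈⟨ sym (+-assoc _ _ _) ⟩
    t i + sum (t ∘ punchIn i) - t i    ≈⟨ +-congʳ (sym (sum-remove {i = i} t)) ⟩
    sum t - t i                        ∎

  ∑-offDiagonal-comm : ∀ n (F : Fin (suc n) → Fin (suc n) → A) →
    ∑[ a < suc n ] ∑[ k < n ] F a (punchIn a k) ≈ ∑[ b < suc n ] ∑[ k < n ] F (punchIn b k) b
  ∑-offDiagonal-comm n F = begin
    ∑[ a < suc n ] ∑[ k < n ] F a (punchIn a k)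
      ≈⟨ sum-cong-≋ {suc n} (λ a → sum-removeAt (F a) a) ⟩
    ∑[ a < suc n ] (sum (F a) - F a a)
      ≈⟨ ∑-distrib-+ (sum ∘ F) (λ a → - F a a) ⟩
    ∑[ a < suc n ] sum (F a) + ∑[ a < suc n ] (- F a a)
      ≈⟨ +-congʳ (∑-comm F) ⟩
    ∑[ b < suc n ] ∑[ a < suc n ] F a b + ∑[ b < suc n ] (- F b b)
      ≈⟨ sym (∑-distrib-+ (λ b → ∑[ a < suc n ] F a b) (λ b → - F b b)) ⟩
    ∑[ b < suc n ] (∑[ a < suc n ] F a b - F b b)
      ≈⟨ sum-cong-≋ {suc n} (λ b → sym (sum-removeAt (λ a → F a b) b)) ⟩
    ∑[ b < suc n ] ∑[ k < n ] F (punchIn b k) b ∎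

  -- Expanding along the first two rows writes det P as a sum over pairs of distinct columns; when these
  -- rows are equal the summands are antisymmetric, so det P ≈ - det P.
  module DoubleExpansion (n : ℕ) (P : Matrix (suc (suc n))) where

    D : Fin (suc (suc n)) → Fin (suc n) → A
    D a k = det n (minor k (minor a P))

    term′ : Fin (suc (suc n)) → Fin (suc (suc n)) → Fin (suc n) → A
    term′ a b k = sign (toℕ a) (sign (toℕ k) (P zero a * (P zero b * D a k)))

    term : Fin (suc (suc n)) → Fin (suc (suc n)) → A
    term a b = term′ a b (punchOut′ a b)

    term-antisym : ∀ a b → a ≢ b → term a b ≈ - term b a
    term-antisym a b a≢b = begin
      term a b                                           ≡⟨ sign-+ℕ (toℕ a) _ _ ⟨
      sign (toℕ a ℕ.+ toℕ (punchOut′ a b)) _            ≈⟨ sign-adjacent _ _ X≈Y (punchOut′-sum-adjacent a b a≢b) ⟩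
      - sign (toℕ b ℕ.+ toℕ (punchOut′ b a)) _          ≡⟨ ≡.cong -_ (sign-+ℕ (toℕ b) _ _) ⟩
      - term b a                                         ∎
      where
      X≈Y : P zero a * (P zero b * D a (punchOut′ a b)) ≈ P zero b * (P zero a * D b (punchOut′ b a))
      X≈Y = trans (*-Comm.x∙yz≈y∙xz _ _ _) (*-congˡ (*-congˡ (det-cong n λ x y →
        reflexive (≡.cong (P (suc (suc x))) (punchIn-punchIn-comm a b a≢b y)))))

    det-expandTwice : (∀ b → P (suc zero) b ≈ P zero b) →
      det (suc (suc n)) P ≈ ∑[ a < suc (suc n) ] ∑[ k < suc n ] term a (punchIn a k)
    det-expandTwice row₁≈row₀ = sum-cong-≋ {suc (suc n)} λ a → begin
      sign (toℕ a) (P zero a * sum (f a))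
        ≈⟨ sign-cong (toℕ a) (*-distribˡ-sum (P zero a) (f a)) ⟩
      sign (toℕ a) (∑[ k < suc n ] (P zero a * f a k))
        ≈⟨ sign-sum (toℕ a) (λ k → P zero a * f a k) ⟩
      ∑[ k < suc n ] sign (toℕ a) (P zero a * f a k)
        ≈⟨ sum-cong-≋ {suc n} (λ k → sign-cong (toℕ a) (step a k)) ⟩
      ∑[ k < suc n ] term′ a (punchIn a k) k
        ≡⟨ sum-cong-≗ {suc n} (λ k → ≡.cong (term′ a (punchIn a k)) (punchOut′-punchIn a k)) ⟨
      ∑[ k < suc n ] term a (punchIn a k) ∎
      where
      f : Fin (suc (suc n)) → Fin (suc n) → A
      f a k = sign (toℕ k) (P (suc zero) (punchIn a k) * D a k)
      step : ∀ a k → P zero a * f a k ≈ sign (toℕ k) (P zero a * (P zero (punchIn a k) * D a k))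
      step a k = trans (sym (sign-*ˡ (toℕ k) _ _)) (sign-cong (toℕ k) (*-congˡ (*-congʳ (row₁≈row₀ _))))

    det≈0 : (∀ b → P (suc zero) b ≈ P zero b) → det (suc (suc n)) P ≈ 0#
    det≈0 row₁≈row₀ = trans (det-expandTwice row₁≈row₀) (noTwoTorsion S (trans (+-congˡ S≈-S) (-‿inverseʳ S)))
      where
      S : A
      S = ∑[ a < suc (suc n) ] ∑[ k < suc n ] term a (punchIn a k)
      S≈-S : S ≈ - S
      S≈-S = begin
        S
          ≈⟨ ∑-offDiagonal-comm (suc n) term ⟩
        ∑[ b < suc (suc n) ] ∑[ k < suc n ] term (punchIn b k) b
          ≈⟨ sum-cong-≋ {suc (suc n)} (λ b → sum-cong-≋ {suc n} λ k → term-antisym (punchIn b k) b (punchInᵢ≢i b k)) ⟩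
        ∑[ b < suc (suc n) ] ∑[ k < suc n ] (- term b (punchIn b k))
          ≈⟨ sum-cong-≋ {suc (suc n)} (λ b → sym (-‿distrib-sum (λ k → term b (punchIn b k)))) ⟩
        ∑[ b < suc (suc n) ] (- ∑[ k < suc n ] term b (punchIn b k))
          ≈⟨ sym (-‿distrib-sum (λ b → ∑[ k < suc n ] term b (punchIn b k))) ⟩
        - S ∎

  swapRows : ∀ {n} → Matrix n → Fin n → Fin n → Matrix n
  swapRows M r s = setRow (setRow M s (M r)) r (M s)

  minor-swapRows₁ : ∀ {n} j (P : Matrix (suc (suc n))) s a b →
    minor j (swapRows P (suc zero) (suc (suc s))) a b ≡ swapRows (minor j P) zero (suc s) a b
  minor-swapRows₁ j P s zero    b = ≡.refl
  minor-swapRows₁ j P s (suc a) b =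
    ≡.cong-app (map-updateAt-local {f = _∘ punchIn j} (λ a → P (suc (suc a))) s ≡.refl a) b

  mutual
    det-equalRows : ∀ n (P : Matrix n) r s → r ≢ s → (∀ b → P r b ≈ P s b) → det n P ≈ 0#
    det-equalRows (suc n)       P zero          zero          r≢s _ = contradiction ≡.refl r≢s
    det-equalRows (suc n)       P (suc r)       (suc s)       r≢s eq = sum-zero (cofactorTerm n P) λ j →
      trans (sign-cong (toℕ j) (trans (*-congˡ (det-equalRows n (minor j P) r s (r≢s ∘ ≡.cong suc) (eq ∘ punchIn j)))
                                      (zeroʳ _)))
            (sign-0# (toℕ j))
    det-equalRows (suc n)       P zero          (suc s)       _ eq = det-equalRows₀ n P s eq
    det-equalRows (suc n)       P (suc r)       zero          _ eq = det-equalRows₀ n P r (sym ∘ eq)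

    det-equalRows₀ : ∀ n (P : Matrix (suc n)) s → (∀ b → P zero b ≈ P (suc s) b) → det (suc n) P ≈ 0#
    det-equalRows₀ (suc n) P zero    eq = DoubleExpansion.det≈0 n P (sym ∘ eq)
    det-equalRows₀ (suc n) P (suc s) eq = begin
      det (suc (suc n)) P        ≈⟨ sym (-‿involutive _) ⟩
      - - det (suc (suc n)) P    ≈⟨ -‿cong (sym (det-Q λ j → det-swapRows (suc n) (minor j P) zero (suc s) λ ())) ⟩
      - det (suc (suc n)) Q      ≈⟨ -‿cong (DoubleExpansion.det≈0 n Q (sym ∘ eq)) ⟩
      - 0#                       ≈⟨ -0#≈0# ⟩
      0#                         ∎
      where
      Q : Matrix (suc (suc n))
      Q = swapRows P (suc zero) (suc (suc s))
      -- The swap lemma for the minors is an argument so that the recursive call stays in the clause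
      -- body, where the termination checker sees the size decrease.
      det-Q : (∀ j → det (suc n) (swapRows (minor j P) zero (suc s)) ≈ - det (suc n) (minor j P)) →
        det (suc (suc n)) Q ≈ - det (suc (suc n)) P
      det-Q swap-minor = begin
        ∑[ j < suc (suc n) ] sign (toℕ j) (P zero j * det (suc n) (minor j Q))
          ≈⟨ sum-cong-≋ {suc (suc n)} (λ j → sign-cong (toℕ j) (*-congˡ {P zero j}
               (trans (det-cong (suc n) λ a b → reflexive (minor-swapRows₁ j P s a b)) (swap-minor j)))) ⟩
        ∑[ j < suc (suc n) ] sign (toℕ j) (P zero j * - det (suc n) (minor j P))
          ≈⟨ sum-cong-≋ {suc (suc n)} (λ j →
               trans (sign-cong (toℕ j) (sym (-‿distribʳ-* (P zero j) (det (suc n) (minor j P)))))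
                     (sign-neg (toℕ j) (P zero j * det (suc n) (minor j P)))) ⟩
        ∑[ j < suc (suc n) ] (- cofactorTerm (suc n) P j)
          ≈⟨ sym (-‿distrib-sum (cofactorTerm (suc n) P)) ⟩
        - det (suc (suc n)) P ∎

    det-swapRows : ∀ n (P : Matrix n) r s → r ≢ s → det n (swapRows P r s) ≈ - det n P
    det-swapRows n P r s r≢s = +-inverseʳ-unique _ _ (begin
      det n P + det n (Φ v u)                                   ≈⟨ +-congʳ (sym (det-cong n Φuv≈P)) ⟩
      det n (Φ u v) + det n (Φ v u)                             ≈⟨ sym (+-cong (trans (+-congʳ (Φ-equal u)) (+-identityˡ _))
                                                                                (trans (+-congˡ (Φ-equal v)) (+-identityʳ _))) ⟩
      (det n (Φ u u) + det n (Φ u v)) + (det n (Φ v u) + det n (Φ v v))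
                                                                ≈⟨ sym (+-cong (Φ-additiveʳ u) (Φ-additiveʳ v)) ⟩
      det n (Φ u w) + det n (Φ v w)                             ≈⟨ sym (det-additive n (setRow P s w) r u v) ⟩
      det n (Φ w w)                                             ≈⟨ Φ-equal w ⟩
      0#                                                        ∎)
      where
      u v w : Fin n → A
      u = P r
      v = P s
      w b = u b + v b
      Φ : (Fin n → A) → (Fin n → A) → Matrix n
      Φ x y = setRow (setRow P s y) r x
      Φuv≈P : ∀ a b → Φ u v a b ≈ P a b
      Φuv≈P a b with a ≟ᶠ r
      ... | yes ≡.refl = reflexive (≡.cong-app (setRow-≡ (setRow P s v) a u) b)
      ... | no a≢r = reflexive (≡.cong-app (≡.trans (setRow-≢ (setRow P s v) u a≢r) (updateAt-id-local s P ≡.refl a)) b)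
      Φ-comm : ∀ x y → det n (Φ x y) ≈ det n (setRow (setRow P r x) s y)
      Φ-comm x y = det-cong n λ a b → reflexive (≡.cong-app (updateAt-commutes r s r≢s P a) b)
      Φ-additiveʳ : ∀ x → det n (Φ x w) ≈ det n (Φ x u) + det n (Φ x v)
      Φ-additiveʳ x = trans (Φ-comm x w) (trans (det-additive n (setRow P r x) s u v)
                        (sym (+-cong (Φ-comm x u) (Φ-comm x v))))
      Φ-equal : ∀ x → det n (Φ x x) ≈ 0#
      Φ-equal x = det-equalRows n (Φ x x) r s r≢s λ b → reflexive (≡.cong-app (≡.trans (setRow-≡ (setRow P s x) r x)
        (≡.sym (≡.trans (setRow-≢ (setRow P s x) x (r≢s ∘ ≡.sym)) (setRow-≡ P s x)))) b)

  det-addRowCombination : ∀ n (P : Matrix n) r {k} (ρ : Fin k → Fin n) (x : Fin k → A) →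
    (∀ s → ρ s ≡ r → x s ≈ 0#) →
    det n (setRow P r (λ b → P r b + ∑[ s < k ] (x s * P (ρ s) b))) ≈ det n P
  det-addRowCombination n P r {k} ρ x x≈0 = begin
    det n (setRow P r (λ b → P r b + ∑[ s < k ] (x s * P (ρ s) b)))
      ≈⟨ det-additive n P r (P r) _ ⟩
    det n (setRow P r (P r)) + det n (setRow P r (λ b → ∑[ s < k ] (x s * P (ρ s) b)))
      ≈⟨ +-cong (det-setRow-self n P r) (det-setRow-sum n P r x (P ∘ ρ)) ⟩
    det n P + ∑[ s < k ] (x s * det n (setRow P r (P (ρ s))))
      ≈⟨ +-congˡ (sum-zero _ vanishes) ⟩
    det n P + 0#
      ≈⟨ +-identityʳ _ ⟩
    det n P ∎
    where
    vanishes : ∀ s → x s * det n (setRow P r (P (ρ s))) ≈ 0#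
    vanishes s with ρ s ≟ᶠ r
    ... | yes ρs≡r = trans (*-congʳ (x≈0 s ρs≡r)) (zeroˡ _)
    ... | no ρs≢r = trans (*-congˡ (det-equalRows n _ r (ρ s) (ρs≢r ∘ ≡.sym) λ b →
            reflexive (≡.cong-app (≡.trans (setRow-≡ P r (P (ρ s))) (≡.sym (setRow-≢ P _ ρs≢r))) b)))
          (zeroʳ _)

  det-addRowCombinations : ∀ n (P Q : Matrix n) {k} (ρ : Fin k → Fin n) (x : Fin n → Fin k → A) →
    (∀ s t → x (ρ s) t ≈ 0#) →
    (∀ r b → Q r b ≈ P r b + ∑[ s < k ] (x r s * P (ρ s) b)) →
    det n Q ≈ det n P
  det-addRowCombinations n P Q {k} ρ x sources-fixed Q≈ =
    trans (sym (det-cong n λ r b → reflexive (prefix-all r b))) (det-prefix n ℕ.≤-refl)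
    where
    prefix : ℕ → Matrix n
    prefix i r = if does (toℕ r ℕ.<? i) then Q r else P r

    prefix-all : ∀ r b → prefix n r b ≡ Q r b
    prefix-all r b = ≡.cong (λ c → (if c then Q r else P r) b) (dec-true (toℕ r ℕ.<? n) (toℕ<n r))

    prefix-source : ∀ i s b → prefix i (ρ s) b ≈ P (ρ s) b
    prefix-source i s b = either (does (toℕ (ρ s) ℕ.<? i))
      where
      either : ∀ c → (if c then Q (ρ s) else P (ρ s)) b ≈ P (ρ s) b
      either true  = trans (Q≈ (ρ s) b) (trans (+-congˡ (sum-zero _ λ t → trans (*-congʳ (sources-fixed s t)) (zeroˡ _)))
                                               (+-identityʳ _))
      either false = refl

    prefix-suc : ∀ i (i<n : i ℕ.< n) a b →
      prefix (suc i) a b ≡ setRow (prefix i) (fromℕ< i<n) (Q (fromℕ< i<n)) a b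
    prefix-suc i i<n a b with a ≟ᶠ fromℕ< i<n
    ... | yes ≡.refl = ≡.trans
      (≡.cong (λ c → (if c then Q a else P a) b)
        (dec-true (toℕ a ℕ.<? suc i) (ℕ.≤-reflexive (≡.cong suc (toℕ-fromℕ< i<n)))))
      (≡.sym (≡.cong-app (setRow-≡ (prefix i) a (Q a)) b))
    ... | no a≢r = ≡.trans
      (≡.cong (λ c → (if c then Q a else P a) b) (same-decision (toℕ a ℕ.<? suc i) (toℕ a ℕ.<? i)))
      (≡.sym (≡.cong-app (setRow-≢ (prefix i) (Q _) a≢r) b))
      where
      toℕa≢i : toℕ a ≢ i
      toℕa≢i eq = a≢r (toℕ-injective (≡.trans eq (≡.sym (toℕ-fromℕ< i<n))))
      same-decision : (d : Dec (toℕ a ℕ.< suc i)) (d′ : Dec (toℕ a ℕ.< i)) → does d ≡ does d′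
      same-decision (yes _)  (yes _)  = ≡.refl
      same-decision (no _)   (no _)   = ≡.refl
      same-decision (yes a<1+i) (no a≮i) = contradiction (ℕ.≤∧≢⇒< (ℕ.s≤s⁻¹ a<1+i) toℕa≢i) a≮i
      same-decision (no a≮1+i) (yes a<i) = contradiction (ℕ.m<n⇒m<1+n a<i) a≮1+i

    det-prefix-suc : ∀ i (i<n : i ℕ.< n) → det n (prefix (suc i)) ≈ det n (prefix i)
    det-prefix-suc i i<n = begin
      det n (prefix (suc i))                       ≈⟨ det-cong n (λ a b → reflexive (prefix-suc i i<n a b)) ⟩
      det n (setRow (prefix i) r (Q r))             ≈⟨ det-cong n (setRow-cong (prefix i) r row-r) ⟩
      det n (setRow (prefix i) r (λ b → prefix i r b + ∑[ s < k ] (x r s * prefix i (ρ s) b)))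
        ≈⟨ det-addRowCombination n (prefix i) r ρ (x r) (λ s ρs≡r →
             ≡.subst (λ q → x q s ≈ 0#) ρs≡r (sources-fixed s s)) ⟩
      det n (prefix i)                              ∎
      where
      r : Fin n
      r = fromℕ< i<n
      prefix-r : ∀ b → prefix i r b ≡ P r b
      prefix-r b = ≡.cong (λ c → (if c then Q r else P r) b)
        (dec-false (toℕ r ℕ.<? i) (λ r<i → ℕ.<-irrefl (toℕ-fromℕ< i<n) r<i))
      row-r : ∀ b → Q r b ≈ prefix i r b + ∑[ s < k ] (x r s * prefix i (ρ s) b)
      row-r b = trans (Q≈ r b) (sym (+-cong (reflexive (prefix-r b))
        (sum-cong-≋ {k} λ s → *-congˡ (prefix-source i s b))))

    det-prefix : ∀ i → i ℕ.≤ n → det n (prefix i) ≈ det n P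
    det-prefix zero    _   = refl
    det-prefix (suc i) i<n = trans (det-prefix-suc i i<n) (det-prefix i (ℕ.<⇒≤ i<n))

  det-scaleRows : ∀ n (x : Fin n → A) (M : Matrix n) → det n (λ a b → x a * M a b) ≈ product x * det n M
  det-scaleRows zero    x M = sym (*-identityˡ 1#)
  det-scaleRows (suc n) x M = begin
    ∑[ j < suc n ] sign (toℕ j) (x zero * M zero j * det n (λ a b → x (suc a) * minor j M a b))
      ≈⟨ sum-cong-≋ {suc n} (λ j → trans (sign-cong (toℕ j) (*-congˡ (det-scaleRows n (x ∘ suc) (minor j M))))
           (trans (sign-cong (toℕ j) (*-Comm.interchange (x zero) (M zero j) _ _)) (sign-*ˡ (toℕ j) _ _))) ⟩
    ∑[ j < suc n ] (product x * cofactorTerm n M j)   ≈⟨ sym (*-distribˡ-sum (product x) (cofactorTerm n M)) ⟩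
    product x * det (suc n) M                          ∎

  scalarMatrix : ∀ {n} → A → Matrix n
  scalarMatrix t i j = if does (i ≟ᶠ j) then t else 0#

  scalarMatrix-diag : ∀ {n} t (i : Fin n) → scalarMatrix t i i ≡ t
  scalarMatrix-diag t i = ≡.cong (if_then t else 0#) (dec-true (i ≟ᶠ i) ≡.refl)

  scalarMatrix-offDiag : ∀ {n} t {i j : Fin n} → i ≢ j → scalarMatrix t i j ≡ 0#
  scalarMatrix-offDiag t {i} {j} i≢j = ≡.cong (if_then t else 0#) (dec-false (i ≟ᶠ j) i≢j)

  ∑-scalarMatrix : ∀ {n} (f : Fin n → A) t l → ∑[ k < n ] (f k * scalarMatrix t k l) ≈ f l * t
  ∑-scalarMatrix {suc n} f t l = begin
    ∑[ k < suc n ] (f k * scalarMatrix t k l)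
      ≈⟨ sum-remove {i = l} (λ k → f k * scalarMatrix t k l) ⟩
    f l * scalarMatrix t l l + ∑[ k < n ] (f (punchIn l k) * scalarMatrix t (punchIn l k) l)
      ≈⟨ +-cong (*-congˡ (reflexive (scalarMatrix-diag t l)))
                (sum-zero _ λ k → trans (*-congˡ (reflexive (scalarMatrix-offDiag t (punchInᵢ≢i l k)))) (zeroʳ _)) ⟩
    f l * t + 0#
      ≈⟨ +-identityʳ _ ⟩
    f l * t ∎

  det-identity : ∀ n (M : Matrix n) → (∀ i j → M i j ≈ scalarMatrix 1# i j) → det n M ≈ 1#
  det-identity zero    M M≈I = refl
  det-identity (suc n) M M≈I = begin
    cofactorTerm n M zero + ∑[ j < n ] cofactorTerm n M (suc j)
      ≈⟨ +-cong (trans (*-cong (M≈I zero zero) (det-identity n (minor zero M) λ i j → M≈I (suc i) (suc j)))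
                       (*-identityˡ 1#))
                (sum-zero _ λ j → trans (sign-cong (toℕ (suc j)) (trans (*-congʳ (M≈I zero (suc j))) (zeroˡ _)))
                                        (sign-0# (toℕ (suc j)))) ⟩
    1# + 0#   ≈⟨ +-identityʳ 1# ⟩
    1#        ∎

  det-zeroColumn : ∀ n (M : Matrix n) c → (∀ a → M a c ≈ 0#) → det n M ≈ 0#
  det-zeroColumn (suc n) M c col≈0 = sum-zero (cofactorTerm n M) term≈0
    where
    term≈0 : ∀ j → cofactorTerm n M j ≈ 0#
    term≈0 j with j ≟ᶠ c
    ... | yes ≡.refl = trans (sign-cong (toℕ j) (trans (*-congʳ (col≈0 zero)) (zeroˡ _))) (sign-0# (toℕ j))
    ... | no j≢c = trans (sign-cong (toℕ j) (trans (*-congˡ minor≈0) (zeroʳ _))) (sign-0# (toℕ j))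
      where
      minor≈0 : det n (minor j M) ≈ 0#
      minor≈0 = det-zeroColumn n (minor j M) (punchOut j≢c)
        (λ a → trans (reflexive (≡.cong (M (suc a)) (punchIn-punchOut j≢c))) (col≈0 (suc a)))

  ↑-view : ∀ N m (a : Fin (N ℕ.+ m)) → (∃ λ i → i ↑ˡ m ≡ a) ⊎ (∃ λ k → N ↑ʳ k ≡ a)
  ↑-view N m a with splitAt N a in eq
  ... | inj₁ i = inj₁ (i , splitAt⁻¹-↑ˡ eq)
  ... | inj₂ k = inj₂ (k , splitAt⁻¹-↑ʳ eq)

  punchIn-↑ˡ : ∀ {N} m (i : Fin (suc N)) j → punchIn (i ↑ˡ m) (j ↑ˡ m) ≡ punchIn i j ↑ˡ m
  punchIn-↑ˡ m zero    j       = ≡.refl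
  punchIn-↑ˡ m (suc i) zero    = ≡.refl
  punchIn-↑ˡ m (suc i) (suc j) = ≡.cong suc (punchIn-↑ˡ m i j)

  punchIn-↑ʳ : ∀ {N} m (i : Fin (suc N)) k → punchIn (i ↑ˡ m) (N ↑ʳ k) ≡ suc N ↑ʳ k
  punchIn-↑ʳ         m zero    k = ≡.refl
  punchIn-↑ʳ {suc N} m (suc i) k = ≡.cong suc (punchIn-↑ʳ m i k)

  det-lowerBlockTriangular : ∀ N m (B : Matrix (N ℕ.+ m)) (C : Matrix N) →
    (∀ i j → B (i ↑ˡ m) (j ↑ˡ m) ≈ C i j) →
    (∀ i k → B (i ↑ˡ m) (N ↑ʳ k) ≈ 0#) →
    (∀ k l → B (N ↑ʳ k) (N ↑ʳ l) ≈ scalarMatrix 1# k l) →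
    det (N ℕ.+ m) B ≈ det N C
  det-lowerBlockTriangular zero    m B C _ _ B≈I = det-identity m B B≈I
  det-lowerBlockTriangular (suc N) m B C B≈C B≈0 B≈I = begin
    sum (cofactorTerm (N ℕ.+ m) B)
      ≈⟨ sum-splitAt (suc N) m (cofactorTerm (N ℕ.+ m) B) ⟩
    ∑[ j < suc N ] cofactorTerm (N ℕ.+ m) B (j ↑ˡ m) + ∑[ k < m ] cofactorTerm (N ℕ.+ m) B (suc N ↑ʳ k)
      ≈⟨ +-cong (sum-cong-≋ {suc N} left) (sum-zero _ right) ⟩
    det (suc N) C + 0#
      ≈⟨ +-identityʳ _ ⟩
    det (suc N) C ∎
    where
    left : ∀ j → cofactorTerm (N ℕ.+ m) B (j ↑ˡ m) ≈ cofactorTerm N C j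
    left j = trans (reflexive (≡.cong (λ e → sign e (B zero (j ↑ˡ m) * det (N ℕ.+ m) (minor (j ↑ˡ m) B))) (toℕ-↑ˡ j m)))
      (sign-cong (toℕ j) (*-cong (B≈C zero j) (det-lowerBlockTriangular N m (minor (j ↑ˡ m) B) (minor j C)
        (λ a b → trans (reflexive (≡.cong (B (suc a ↑ˡ m)) (punchIn-↑ˡ m j b))) (B≈C (suc a) (punchIn j b)))
        (λ a k → trans (reflexive (≡.cong (B (suc a ↑ˡ m)) (punchIn-↑ʳ m j k))) (B≈0 (suc a) k))
        (λ k l → trans (reflexive (≡.cong (B (suc N ↑ʳ k)) (punchIn-↑ʳ m j l))) (B≈I k l)))))
    right : ∀ k → cofactorTerm (N ℕ.+ m) B (suc N ↑ʳ k) ≈ 0#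
    right k = trans (sign-cong (toℕ (suc N ↑ʳ k)) (trans (*-congʳ (B≈0 zero k)) (zeroˡ _))) (sign-0# (toℕ (suc N ↑ʳ k)))

  det-upperBlockTriangular : ∀ N m (B : Matrix (N ℕ.+ m)) (D : Matrix m) t →
    (∀ i j → B (i ↑ˡ m) (j ↑ˡ m) ≈ scalarMatrix t i j) →
    (∀ k j → B (N ↑ʳ k) (j ↑ˡ m) ≈ 0#) →
    (∀ k l → B (N ↑ʳ k) (N ↑ʳ l) ≈ D k l) →
    det (N ℕ.+ m) B ≈ t ^ N * det m D
  det-upperBlockTriangular zero    m B D t _ _ B≈D = trans (det-cong m B≈D) (sym (*-identityˡ _))
  det-upperBlockTriangular (suc N) m B D t B≈tI B≈0 B≈D = begin
    sum (cofactorTerm (N ℕ.+ m) B)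
      ≈⟨ sum-splitAt (suc N) m (cofactorTerm (N ℕ.+ m) B) ⟩
    (cofactorTerm (N ℕ.+ m) B zero + ∑[ j < N ] cofactorTerm (N ℕ.+ m) B (suc j ↑ˡ m))
      + ∑[ k < m ] cofactorTerm (N ℕ.+ m) B (suc N ↑ʳ k)
      ≈⟨ +-cong (+-cong first (sum-zero _ rest)) (sum-zero _ right) ⟩
    (t ^ suc N * det m D + 0#) + 0#
      ≈⟨ trans (+-identityʳ _) (+-identityʳ _) ⟩
    t ^ suc N * det m D ∎
    where
    first : cofactorTerm (N ℕ.+ m) B zero ≈ t ^ suc N * det m D
    first = trans (*-cong (B≈tI zero zero) (det-upperBlockTriangular N m (minor zero B) D t
                            (λ i j → B≈tI (suc i) (suc j)) (λ k j → B≈0 k (suc j)) B≈D))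
                  (sym (*-assoc _ _ _))
    rest : ∀ j → cofactorTerm (N ℕ.+ m) B (suc j ↑ˡ m) ≈ 0#
    rest j = trans (sign-cong (toℕ (suc j ↑ˡ m)) (trans (*-congʳ (B≈tI zero (suc j))) (zeroˡ _)))
                   (sign-0# (toℕ (suc j ↑ˡ m)))
    column₀ : ∀ a → B (suc a) zero ≈ 0#
    column₀ a with ↑-view N m a
    ... | inj₁ (i , ≡.refl) = B≈tI (suc i) zero
    ... | inj₂ (k , ≡.refl) = B≈0 k zero
    right : ∀ k → cofactorTerm (N ℕ.+ m) B (suc N ↑ʳ k) ≈ 0#
    right k = trans (sign-cong (toℕ (suc N ↑ʳ k)) (trans (*-congˡ minor≈0) (zeroʳ _))) (sign-0# (toℕ (suc N ↑ʳ k)))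
      where
      j≢0 : suc N ↑ʳ k ≢ zero
      j≢0 ()
      minor≈0 : det (N ℕ.+ m) (minor (suc N ↑ʳ k) B) ≈ 0#
      minor≈0 = det-zeroColumn (N ℕ.+ m) _ (punchOut j≢0)
        λ a → trans (reflexive (≡.cong (B (suc a)) (punchIn-punchOut j≢0))) (column₀ a)

  ↑-cases : ∀ {p N m} (Pr : Fin (N ℕ.+ m) → Set p) →
    (∀ i → Pr (i ↑ˡ m)) → (∀ k → Pr (N ↑ʳ k)) → ∀ a → Pr a
  ↑-cases {N = N} {m} Pr left right a with ↑-view N m a
  ... | inj₁ (i , ≡.refl) = left i
  ... | inj₂ (k , ≡.refl) = right k

  ≈-via-≡ : ∀ {p q x y} → p ≡ x → q ≡ y → x ≈ y → p ≈ q
  ≈-via-≡ ≡.refl ≡.refl x≈y = x≈y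

  module Block {N m : ℕ} (TL : Fin N → Fin N → A) (TR : Fin N → Fin m → A)
                          (BL : Fin m → Fin N → A) (BR : Fin m → Fin m → A) where

    private
      rowsᵗ : Fin N → Fin (N ℕ.+ m) → A
      rowsᵗ i = TL i ++ TR i
      rowsᵇ : Fin m → Fin (N ℕ.+ m) → A
      rowsᵇ k = BL k ++ BR k

    matrix : Matrix (N ℕ.+ m)
    matrix = rowsᵗ ++ rowsᵇ

    tl : ∀ i j → matrix (i ↑ˡ m) (j ↑ˡ m) ≡ TL i j
    tl i j = ≡.trans (≡.cong-app (lookup-++ˡ rowsᵗ rowsᵇ i) (j ↑ˡ m)) (lookup-++ˡ (TL i) (TR i) j)

    tr : ∀ i l → matrix (i ↑ˡ m) (N ↑ʳ l) ≡ TR i l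
    tr i l = ≡.trans (≡.cong-app (lookup-++ˡ rowsᵗ rowsᵇ i) (N ↑ʳ l)) (lookup-++ʳ (TL i) (TR i) l)

    bl : ∀ k j → matrix (N ↑ʳ k) (j ↑ˡ m) ≡ BL k j
    bl k j = ≡.trans (≡.cong-app (lookup-++ʳ rowsᵗ rowsᵇ k) (j ↑ˡ m)) (lookup-++ˡ (BL k) (BR k) j)

    br : ∀ k l → matrix (N ↑ʳ k) (N ↑ʳ l) ≡ BR k l
    br k l = ≡.trans (≡.cong-app (lookup-++ʳ rowsᵗ rowsᵇ k) (N ↑ʳ l)) (lookup-++ʳ (BL k) (BR k) l)

  product-splitAt : ∀ N m (f : Fin (N ℕ.+ m) → A) →
    product f ≈ product (λ i → f (i ↑ˡ m)) * product (λ k → f (N ↑ʳ k))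
  product-splitAt zero    m f = sym (*-identityˡ _)
  product-splitAt (suc N) m f = trans (*-congˡ (product-splitAt N m (f ∘ suc))) (sym (*-assoc _ _ _))

  det-addBottomToTop : ∀ N m (P Q : Matrix (N ℕ.+ m)) (K : Fin N → Fin m → A) →
    (∀ i b → Q (i ↑ˡ m) b ≈ P (i ↑ˡ m) b + ∑[ k < m ] (K i k * P (N ↑ʳ k) b)) →
    (∀ k b → Q (N ↑ʳ k) b ≈ P (N ↑ʳ k) b) →
    det (N ℕ.+ m) Q ≈ det (N ℕ.+ m) P
  det-addBottomToTop N m P Q K top bottom =
    det-addRowCombinations (N ℕ.+ m) P Q (N ↑ʳ_) x (λ k l → reflexive (≡.cong-app (lookup-++ʳ K zeros k) l))
      (λ r b → ↑-cases (λ r → Q r b ≈ P r b + ∑[ k < m ] (x r k * P (N ↑ʳ k) b))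
        (λ i → trans (top i b) (+-congˡ (sum-cong-≋ {m} λ k →
          *-congʳ (reflexive (≡.sym (≡.cong-app (lookup-++ˡ K zeros i) k))))))
        (λ k → trans (bottom k b) (sym (trans (+-congˡ (sum-zero _ λ l →
          trans (*-congʳ (reflexive (≡.cong-app (lookup-++ʳ K zeros k) l))) (zeroˡ _))) (+-identityʳ _))))
        r)
    where
    zeros : Fin m → Fin m → A
    zeros _ _ = 0#
    x : Fin (N ℕ.+ m) → Fin m → A
    x = K ++ zeros

  det-addTopToBottom : ∀ N m (P Q : Matrix (N ℕ.+ m)) (K : Fin m → Fin N → A) →
    (∀ i b → Q (i ↑ˡ m) b ≈ P (i ↑ˡ m) b) →
    (∀ k b → Q (N ↑ʳ k) b ≈ P (N ↑ʳ k) b + ∑[ i < N ] (K k i * P (i ↑ˡ m) b)) →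
    det (N ℕ.+ m) Q ≈ det (N ℕ.+ m) P
  det-addTopToBottom N m P Q K top bottom =
    det-addRowCombinations (N ℕ.+ m) P Q (_↑ˡ m) x (λ i j → reflexive (≡.cong-app (lookup-++ˡ zeros K i) j))
      (λ r b → ↑-cases (λ r → Q r b ≈ P r b + ∑[ i < N ] (x r i * P (i ↑ˡ m) b))
        (λ i → trans (top i b) (sym (trans (+-congˡ (sum-zero _ λ j →
          trans (*-congʳ (reflexive (≡.cong-app (lookup-++ˡ zeros K i) j))) (zeroˡ _))) (+-identityʳ _))))
        (λ k → trans (bottom k b) (+-congˡ (sum-cong-≋ {N} λ i →
          *-congʳ (reflexive (≡.sym (≡.cong-app (lookup-++ʳ zeros K k) i))))))
        r)
    where
    zeros : Fin N → Fin N → A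
    zeros _ _ = 0#
    x : Fin (N ℕ.+ m) → Fin N → A
    x = zeros ++ K

  -- Sylvester's identity

  _·_ : ∀ {N m p} → (Fin N → Fin m → A) → (Fin m → Fin p → A) → Fin N → Fin p → A
  _·_ {m = m} U V x y = ∑[ J < m ] (U x J * V J y)

  characteristic : ∀ n → Matrix n → A → A
  characteristic n M t = det n (λ i j → scalarMatrix t i j - M i j)

  -- With C = [tI, U; tV, tI]: pulling t out of the last m rows and then clearing the top-right block gives
  -- det C = t^m det(tI − UV); clearing the bottom-left block instead gives det C = t^N det(tI − VU).
  module _ {N m : ℕ} (U : Fin N → Fin m → A) (V : Fin m → Fin N → A) (t : A) where

    private
      tV : Fin m → Fin N → A
      tV k j = t * V k j
      tI-UV : Fin N → Fin N → A
      tI-UV i j = scalarMatrix t i j - (U · V) i j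
      tI-VU : Fin m → Fin m → A
      tI-VU k l = scalarMatrix t k l - (V · U) k l
      0ᵗʳ : Fin N → Fin m → A
      0ᵗʳ _ _ = 0#
      0ᵇˡ : Fin m → Fin N → A
      0ᵇˡ _ _ = 0#

      module C  = Block (scalarMatrix t) U tV (scalarMatrix t)
      module C₀ = Block (scalarMatrix t) U V (scalarMatrix 1#)
      module C₁ = Block tI-UV 0ᵗʳ V (scalarMatrix 1#)
      module C₂ = Block (scalarMatrix t) U 0ᵇˡ tI-VU

      1s : Fin N → A
      1s _ = 1#
      ts : Fin m → A
      ts _ = t
      rowScale : Fin (N ℕ.+ m) → A
      rowScale = 1s ++ ts

      scalarMatrix-* : ∀ {n} (k l : Fin n) → scalarMatrix t k l ≈ t * scalarMatrix 1# k l
      scalarMatrix-* k l with k ≟ᶠ l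
      ... | yes _ = sym (*-identityʳ t)
      ... | no _  = sym (zeroʳ t)

      product-rowScale : product {N ℕ.+ m} rowScale ≈ t ^ m
      product-rowScale = begin
        product {N ℕ.+ m} rowScale ≈⟨ product-splitAt N m rowScale ⟩
        product (λ i → rowScale (i ↑ˡ m)) * product (λ k → rowScale (N ↑ʳ k))
          ≈⟨ *-cong (trans (product-cong {N} (λ i → reflexive (lookup-++ˡ 1s ts i)))
                           (product-replicate-1# N))
                    (trans (product-cong {m} (λ k → reflexive (lookup-++ʳ 1s ts k)))
                           (product-replicate m)) ⟩
        1# * t ^ m ≈⟨ *-identityˡ _ ⟩
        t ^ m ∎

      C-scaled : ∀ a b → C.matrix a b ≈ rowScale a * C₀.matrix a b
      C-scaled = ↑-cases (λ a → ∀ b → C.matrix a b ≈ rowScale a * C₀.matrix a b)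
        (λ i → ↑-cases _
          (λ j → ≈-via-≡ (C.tl i j) (≡.cong₂ _*_ (lookup-++ˡ 1s ts i) (C₀.tl i j)) (sym (*-identityˡ _)))
          (λ l → ≈-via-≡ (C.tr i l) (≡.cong₂ _*_ (lookup-++ˡ 1s ts i) (C₀.tr i l)) (sym (*-identityˡ _))))
        (λ k → ↑-cases _
          (λ j → ≈-via-≡ (C.bl k j) (≡.cong₂ _*_ (lookup-++ʳ 1s ts k) (C₀.bl k j)) refl)
          (λ l → ≈-via-≡ (C.br k l) (≡.cong₂ _*_ (lookup-++ʳ 1s ts k) (C₀.br k l)) (scalarMatrix-* k l)))

      C₁-fromC₀ : ∀ i b →
        C₁.matrix (i ↑ˡ m) b ≈ C₀.matrix (i ↑ˡ m) b + ∑[ k < m ] (- U i k * C₀.matrix (N ↑ʳ k) b)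
      C₁-fromC₀ i = ↑-cases _
        (λ j → ≈-via-≡ (C₁.tl i j)
          (≡.cong₂ _+_ (C₀.tl i j) (sum-cong-≗ {m} λ k → ≡.cong (- U i k *_) (C₀.bl k j)))
          (+-congˡ (trans (-‿distrib-sum (λ k → U i k * V k j)) (sum-cong-≋ {m} λ k → -‿distribˡ-* _ _))))
        (λ l → ≈-via-≡ (C₁.tr i l)
          (≡.cong₂ _+_ (C₀.tr i l) (sum-cong-≗ {m} λ k → ≡.cong (- U i k *_) (C₀.br k l)))
          (sym (trans (+-congˡ (trans (∑-scalarMatrix _ 1# l) (*-identityʳ _))) (-‿inverseʳ _))))

      C₂-fromC : ∀ k b →
        C₂.matrix (N ↑ʳ k) b ≈ C.matrix (N ↑ʳ k) b + ∑[ i < N ] (- V k i * C.matrix (i ↑ˡ m) b)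
      C₂-fromC k = ↑-cases _
        (λ j → ≈-via-≡ (C₂.bl k j)
          (≡.cong₂ _+_ (C.bl k j) (sum-cong-≗ {N} λ i → ≡.cong (- V k i *_) (C.tl i j)))
          (sym (trans (+-congˡ (∑-scalarMatrix _ t j)) (trans (+-congˡ (sym (-‿distribˡ-* _ _)))
            (trans (+-congˡ (-‿cong (*-comm _ _))) (-‿inverseʳ _))))))
        (λ l → ≈-via-≡ (C₂.br k l)
          (≡.cong₂ _+_ (C.br k l) (sum-cong-≗ {N} λ i → ≡.cong (- V k i *_) (C.tr i l)))
          (+-congˡ (trans (-‿distrib-sum (λ i → V k i * U i l)) (sum-cong-≋ {N} λ i → -‿distribˡ-* _ _))))

      det-C : det (N ℕ.+ m) C.matrix ≈ t ^ m * det (N ℕ.+ m) C₀.matrix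
      det-C = trans (det-cong (N ℕ.+ m) C-scaled)
                    (trans (det-scaleRows (N ℕ.+ m) rowScale C₀.matrix) (*-congʳ product-rowScale))

      det-C₁ : det (N ℕ.+ m) C₁.matrix ≈ det (N ℕ.+ m) C₀.matrix
      det-C₁ = det-addBottomToTop N m C₀.matrix C₁.matrix (λ i k → - U i k) C₁-fromC₀ λ k → ↑-cases _
        (λ j → reflexive (≡.trans (C₁.bl k j) (≡.sym (C₀.bl k j))))
        (λ l → reflexive (≡.trans (C₁.br k l) (≡.sym (C₀.br k l))))

      det-C₂ : det (N ℕ.+ m) C₂.matrix ≈ det (N ℕ.+ m) C.matrix
      det-C₂ = det-addTopToBottom N m C.matrix C₂.matrix (λ k i → - V k i) (λ i → ↑-cases _
        (λ j → reflexive (≡.trans (C₂.tl i j) (≡.sym (C.tl i j))))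
        (λ l → reflexive (≡.trans (C₂.tr i l) (≡.sym (C.tr i l))))) C₂-fromC

    sylvester : t ^ m * characteristic N (U · V) t ≈ t ^ N * characteristic m (V · U) t
    sylvester = begin
      t ^ m * characteristic N (U · V) t
        ≈⟨ *-congˡ (sym (det-lowerBlockTriangular N m C₁.matrix _
             (λ i j → reflexive (C₁.tl i j)) (λ i k → reflexive (C₁.tr i k)) (λ k l → reflexive (C₁.br k l)))) ⟩
      t ^ m * det (N ℕ.+ m) C₁.matrix  ≈⟨ *-congˡ det-C₁ ⟩
      t ^ m * det (N ℕ.+ m) C₀.matrix  ≈⟨ sym det-C ⟩
      det (N ℕ.+ m) C.matrix           ≈⟨ sym det-C₂ ⟩
      det (N ℕ.+ m) C₂.matrix
        ≈⟨ det-upperBlockTriangular N m C₂.matrix _ t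
             (λ i j → reflexive (C₂.tl i j)) (λ k j → reflexive (C₂.bl k j)) (λ k l → reflexive (C₂.br k l)) ⟩
      t ^ N * characteristic m (V · U) t ∎

module IntegerPolynomials where

  open import Algebra.Bundles using (Semiring)
  import Algebra.Properties.CommutativeSemigroup as CommutativeSemigroupProperties
  open import Data.Fin.Base using (Fin; zero; suc; toℕ)
  open import Data.Integer.Base as ℤ using (ℤ; +_)
  import Data.Integer.Properties as ℤ
  open import Data.List.Base using ([]; _∷_; map)
  open import Data.Nat.Base as ℕ using (ℕ; zero; suc)
  import Data.Nat.Properties as ℕ
  open import Data.Product.Base using (Σ; _,_)
  open import Data.Sum.Base using (_⊎_; inj₁; inj₂)
  open import Level using (0ℓ)
  open import Relation.Binary.Bundles using (Setoid)
  open import Relation.Binary.PropositionalEquality as ≡ using ()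
  open import Relation.Binary.Structures using (IsEquivalence)

  open import Defs using (Poly; coeff; _≋_; _+ₚ_; -ₚ_; _*ₚ_; oneₚ; Xₚ; _^ₚ_; Σℕ; Σₚ; sgn; charPoly)
    renaming (det to detₚ)

  -- Coefficientwise equality, wrapped in a record so that its arguments can be inferred.
  record _≈ₚ_ (p q : Poly) : Set where
    constructor mk
    field coeff-≡ : p ≋ q
  open _≈ₚ_ public

  ≈ₚ-isEquivalence : IsEquivalence _≈ₚ_
  ≈ₚ-isEquivalence = record
    { refl  = mk λ _ → ≡.refl
    ; sym   = λ p≈q → mk λ k → ≡.sym (coeff-≡ p≈q k)
    ; trans = λ p≈q q≈r → mk λ k → ≡.trans (coeff-≡ p≈q k) (coeff-≡ q≈r k)
    }

  open IsEquivalence ≈ₚ-isEquivalence using ()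
    renaming (refl to ≈ₚ-refl; sym to ≈ₚ-sym; trans to ≈ₚ-trans; reflexive to ≈ₚ-reflexive)

  ≈ₚ-setoid : Setoid 0ℓ 0ℓ
  ≈ₚ-setoid = record { isEquivalence = ≈ₚ-isEquivalence }

  open import Relation.Binary.Reasoning.Setoid ≈ₚ-setoid

  scale : ℤ → Poly → Poly
  scale a = map (a ℤ.*_)

  shift : Poly → Poly
  shift p = + 0 ∷ p

  coeff-+ₚ : ∀ p q k → coeff (p +ₚ q) k ≡ coeff p k ℤ.+ coeff q k
  coeff-+ₚ []      q       k       = ≡.sym (ℤ.+-identityˡ _)
  coeff-+ₚ (a ∷ p) []      k       = ≡.sym (ℤ.+-identityʳ _)
  coeff-+ₚ (a ∷ p) (b ∷ q) zero    = ≡.refl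
  coeff-+ₚ (a ∷ p) (b ∷ q) (suc k) = coeff-+ₚ p q k

  coeff-map : ∀ (f : ℤ → ℤ) → f (+ 0) ≡ + 0 → ∀ p k → coeff (map f p) k ≡ f (coeff p k)
  coeff-map f f0≡0 []      k       = ≡.sym f0≡0
  coeff-map f f0≡0 (a ∷ p) zero    = ≡.refl
  coeff-map f f0≡0 (a ∷ p) (suc k) = coeff-map f f0≡0 p k

  coeff-neg : ∀ p k → coeff (-ₚ p) k ≡ ℤ.- coeff p k
  coeff-neg = coeff-map ℤ.-_ ≡.refl

  coeff-scale : ∀ a p k → coeff (scale a p) k ≡ a ℤ.* coeff p k
  coeff-scale a = coeff-map (a ℤ.*_) (ℤ.*-zeroʳ a)

  ∷-cong : ∀ {a b p q} → a ≡ b → p ≈ₚ q → (a ∷ p) ≈ₚ (b ∷ q)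
  ∷-cong a≡b p≈q = mk λ { zero → a≡b ; (suc k) → coeff-≡ p≈q k }

  coeffwise : ∀ {p q} (f g : ℕ → ℤ) →
    (∀ k → coeff p k ≡ f k) → (∀ k → coeff q k ≡ g k) → (∀ k → f k ≡ g k) → p ≈ₚ q
  coeffwise f g p≡f q≡g f≡g = mk λ k → ≡.trans (p≡f k) (≡.trans (f≡g k) (≡.sym (q≡g k)))

  +ₚ-cong : ∀ {p p′ q q′} → p ≈ₚ p′ → q ≈ₚ q′ → (p +ₚ q) ≈ₚ (p′ +ₚ q′)
  +ₚ-cong {p} {p′} {q} {q′} p≈p′ q≈q′ = coeffwise _ _ (coeff-+ₚ p q) (coeff-+ₚ p′ q′)
    λ k → ≡.cong₂ ℤ._+_ (coeff-≡ p≈p′ k) (coeff-≡ q≈q′ k)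

  +ₚ-assoc : ∀ p q r → ((p +ₚ q) +ₚ r) ≈ₚ (p +ₚ (q +ₚ r))
  +ₚ-assoc p q r = coeffwise _ _
    (λ k → ≡.trans (coeff-+ₚ (p +ₚ q) r k) (≡.cong (ℤ._+ coeff r k) (coeff-+ₚ p q k)))
    (λ k → ≡.trans (coeff-+ₚ p (q +ₚ r) k) (≡.cong (λ z → coeff p k ℤ.+ z) (coeff-+ₚ q r k)))
    λ k → ℤ.+-assoc (coeff p k) (coeff q k) (coeff r k)

  +ₚ-comm : ∀ p q → (p +ₚ q) ≈ₚ (q +ₚ p)
  +ₚ-comm p q = coeffwise _ _ (coeff-+ₚ p q) (coeff-+ₚ q p) λ k → ℤ.+-comm (coeff p k) (coeff q k)

  +ₚ-identityʳ : ∀ p → (p +ₚ []) ≈ₚ p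
  +ₚ-identityʳ p = mk λ k → ≡.trans (coeff-+ₚ p [] k) (ℤ.+-identityʳ _)

  -ₚ-cong : ∀ {p q} → p ≈ₚ q → (-ₚ p) ≈ₚ (-ₚ q)
  -ₚ-cong {p} {q} p≈q = coeffwise _ _ (coeff-neg p) (coeff-neg q) λ k → ≡.cong ℤ.-_ (coeff-≡ p≈q k)

  -ₚ-inverseˡ : ∀ p → ((-ₚ p) +ₚ p) ≈ₚ []
  -ₚ-inverseˡ p = mk λ k → ≡.trans (coeff-+ₚ (-ₚ p) p k)
    (≡.trans (≡.cong (ℤ._+ coeff p k) (coeff-neg p k)) (ℤ.+-inverseˡ (coeff p k)))

  -ₚ-inverseʳ : ∀ p → (p +ₚ (-ₚ p)) ≈ₚ []
  -ₚ-inverseʳ p = ≈ₚ-trans (+ₚ-comm p (-ₚ p)) (-ₚ-inverseˡ p)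

  scale-cong : ∀ a {p q} → p ≈ₚ q → scale a p ≈ₚ scale a q
  scale-cong a {p} {q} p≈q = coeffwise _ _ (coeff-scale a p) (coeff-scale a q) λ k → ≡.cong (a ℤ.*_) (coeff-≡ p≈q k)

  scale-+ₚ : ∀ a p q → scale a (p +ₚ q) ≈ₚ (scale a p +ₚ scale a q)
  scale-+ₚ a p q = coeffwise _ _
    (λ k → ≡.trans (coeff-scale a (p +ₚ q) k) (≡.cong (a ℤ.*_) (coeff-+ₚ p q k)))
    (λ k → ≡.trans (coeff-+ₚ (scale a p) (scale a q) k) (≡.cong₂ ℤ._+_ (coeff-scale a p k) (coeff-scale a q k)))
    λ k → ℤ.*-distribˡ-+ a (coeff p k) (coeff q k)

  scale-distribʳ : ∀ a b p → scale (a ℤ.+ b) p ≈ₚ (scale a p +ₚ scale b p)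
  scale-distribʳ a b p = coeffwise _ _ (coeff-scale (a ℤ.+ b) p)
    (λ k → ≡.trans (coeff-+ₚ (scale a p) (scale b p) k) (≡.cong₂ ℤ._+_ (coeff-scale a p k) (coeff-scale b p k)))
    λ k → ℤ.*-distribʳ-+ (coeff p k) a b

  scale-0 : ∀ p → scale (+ 0) p ≈ₚ []
  scale-0 p = mk (coeff-scale (+ 0) p)

  scale-1 : ∀ p → scale (+ 1) p ≈ₚ p
  scale-1 p = mk λ k → ≡.trans (coeff-scale (+ 1) p k) (ℤ.*-identityˡ _)

  scale-scale : ∀ a b p → scale a (scale b p) ≈ₚ scale (a ℤ.* b) p
  scale-scale a b p = coeffwise _ _
    (λ k → ≡.trans (coeff-scale a (scale b p) k) (≡.cong (a ℤ.*_) (coeff-scale b p k)))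
    (coeff-scale (a ℤ.* b) p)
    λ k → ≡.sym (ℤ.*-assoc a b (coeff p k))

  shift-[] : shift [] ≈ₚ []
  shift-[] = mk λ { zero → ≡.refl ; (suc k) → ≡.refl }

  scale-shift : ∀ a p → scale a (shift p) ≈ₚ shift (scale a p)
  scale-shift a p = ∷-cong (ℤ.*-zeroʳ a) ≈ₚ-refl

  *ₚ-congʳ : ∀ p {q q′} → q ≈ₚ q′ → (p *ₚ q) ≈ₚ (p *ₚ q′)
  *ₚ-congʳ []      q≈q′ = ≈ₚ-refl
  *ₚ-congʳ (a ∷ p) q≈q′ = +ₚ-cong (scale-cong a q≈q′) (∷-cong ≡.refl (*ₚ-congʳ p q≈q′))

  *ₚ-zeroʳ : ∀ p → (p *ₚ []) ≈ₚ []
  *ₚ-zeroʳ []      = ≈ₚ-refl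
  *ₚ-zeroʳ (a ∷ p) = ≈ₚ-trans (∷-cong ≡.refl (*ₚ-zeroʳ p)) shift-[]

  *ₚ-∷ʳ : ∀ q b r → (q *ₚ (b ∷ r)) ≈ₚ (scale b q +ₚ shift (q *ₚ r))
  *ₚ-∷ʳ []      b r = ≈ₚ-sym shift-[]
  *ₚ-∷ʳ (a ∷ q) b r = ∷-cong (≡.cong (ℤ._+ + 0) (ℤ.*-comm a b)) (begin
    scale a r +ₚ (q *ₚ (b ∷ r))                   ≈⟨ +ₚ-cong ≈ₚ-refl (*ₚ-∷ʳ q b r) ⟩
    scale a r +ₚ (scale b q +ₚ shift (q *ₚ r))    ≈⟨ ≈ₚ-sym (+ₚ-assoc (scale a r) (scale b q) _) ⟩
    (scale a r +ₚ scale b q) +ₚ shift (q *ₚ r)    ≈⟨ +ₚ-cong (+ₚ-comm (scale a r) (scale b q)) ≈ₚ-refl ⟩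
    (scale b q +ₚ scale a r) +ₚ shift (q *ₚ r)    ≈⟨ +ₚ-assoc (scale b q) (scale a r) _ ⟩
    scale b q +ₚ (scale a r +ₚ shift (q *ₚ r))    ∎)

  *ₚ-comm : ∀ p q → (p *ₚ q) ≈ₚ (q *ₚ p)
  *ₚ-comm []      q = ≈ₚ-sym (*ₚ-zeroʳ q)
  *ₚ-comm (a ∷ p) q = ≈ₚ-trans (+ₚ-cong ≈ₚ-refl (∷-cong ≡.refl (*ₚ-comm p q))) (≈ₚ-sym (*ₚ-∷ʳ q a p))

  *ₚ-cong : ∀ {p p′ q q′} → p ≈ₚ p′ → q ≈ₚ q′ → (p *ₚ q) ≈ₚ (p′ *ₚ q′)
  *ₚ-cong {p} {p′} {q} {q′} p≈p′ q≈q′ =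
    ≈ₚ-trans (*ₚ-comm p q) (≈ₚ-trans (*ₚ-congʳ q p≈p′) (≈ₚ-trans (*ₚ-comm q p′) (*ₚ-congʳ p′ q≈q′)))

  +ₚ-interchange : ∀ w x y z → ((w +ₚ x) +ₚ (y +ₚ z)) ≈ₚ ((w +ₚ y) +ₚ (x +ₚ z))
  +ₚ-interchange w x y z = coeffwise _ _
    (λ k → ≡.trans (coeff-+ₚ (w +ₚ x) (y +ₚ z) k) (≡.cong₂ ℤ._+_ (coeff-+ₚ w x k) (coeff-+ₚ y z k)))
    (λ k → ≡.trans (coeff-+ₚ (w +ₚ y) (x +ₚ z) k) (≡.cong₂ ℤ._+_ (coeff-+ₚ w y k) (coeff-+ₚ x z k)))
    λ k → CommutativeSemigroupProperties.interchange ℤ.+-commutativeSemigroup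
            (coeff w k) (coeff x k) (coeff y k) (coeff z k)

  *ₚ-distribʳ : ∀ p p′ q → ((p +ₚ p′) *ₚ q) ≈ₚ ((p *ₚ q) +ₚ (p′ *ₚ q))
  *ₚ-distribʳ []      p′       q = ≈ₚ-refl
  *ₚ-distribʳ (a ∷ p) []       q = ≈ₚ-sym (+ₚ-identityʳ ((a ∷ p) *ₚ q))
  *ₚ-distribʳ (a ∷ p) (b ∷ p′) q = begin
    scale (a ℤ.+ b) q +ₚ shift ((p +ₚ p′) *ₚ q)
      ≈⟨ +ₚ-cong (scale-distribʳ a b q) (∷-cong ≡.refl (*ₚ-distribʳ p p′ q)) ⟩
    (scale a q +ₚ scale b q) +ₚ (shift (p *ₚ q) +ₚ shift (p′ *ₚ q))
      ≈⟨ +ₚ-interchange (scale a q) (scale b q) (shift (p *ₚ q)) (shift (p′ *ₚ q)) ⟩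
    (scale a q +ₚ shift (p *ₚ q)) +ₚ (scale b q +ₚ shift (p′ *ₚ q)) ∎

  *ₚ-distribˡ : ∀ p q q′ → (p *ₚ (q +ₚ q′)) ≈ₚ ((p *ₚ q) +ₚ (p *ₚ q′))
  *ₚ-distribˡ p q q′ = ≈ₚ-trans (*ₚ-comm p (q +ₚ q′))
    (≈ₚ-trans (*ₚ-distribʳ q q′ p) (+ₚ-cong (*ₚ-comm q p) (*ₚ-comm q′ p)))

  scale-*ₚ : ∀ a q r → (scale a q *ₚ r) ≈ₚ scale a (q *ₚ r)
  scale-*ₚ a []      r = ≈ₚ-refl
  scale-*ₚ a (b ∷ q) r = begin
    scale (a ℤ.* b) r +ₚ shift (scale a q *ₚ r)
      ≈⟨ +ₚ-cong (≈ₚ-sym (scale-scale a b r)) (∷-cong ≡.refl (scale-*ₚ a q r)) ⟩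
    scale a (scale b r) +ₚ shift (scale a (q *ₚ r))
      ≈⟨ +ₚ-cong ≈ₚ-refl (≈ₚ-sym (scale-shift a (q *ₚ r))) ⟩
    scale a (scale b r) +ₚ scale a (shift (q *ₚ r))
      ≈⟨ ≈ₚ-sym (scale-+ₚ a (scale b r) (shift (q *ₚ r))) ⟩
    scale a (scale b r +ₚ shift (q *ₚ r)) ∎

  shift-*ₚ : ∀ p r → (shift p *ₚ r) ≈ₚ shift (p *ₚ r)
  shift-*ₚ p r = +ₚ-cong (scale-0 r) ≈ₚ-refl

  *ₚ-assoc : ∀ p q r → ((p *ₚ q) *ₚ r) ≈ₚ (p *ₚ (q *ₚ r))
  *ₚ-assoc []      q r = ≈ₚ-refl
  *ₚ-assoc (a ∷ p) q r = begin
    (scale a q +ₚ shift (p *ₚ q)) *ₚ r           ≈⟨ *ₚ-distribʳ (scale a q) (shift (p *ₚ q)) r ⟩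
    (scale a q *ₚ r) +ₚ (shift (p *ₚ q) *ₚ r)    ≈⟨ +ₚ-cong (scale-*ₚ a q r) (shift-*ₚ (p *ₚ q) r) ⟩
    scale a (q *ₚ r) +ₚ shift ((p *ₚ q) *ₚ r)    ≈⟨ +ₚ-cong ≈ₚ-refl (∷-cong ≡.refl (*ₚ-assoc p q r)) ⟩
    scale a (q *ₚ r) +ₚ shift (p *ₚ (q *ₚ r))    ∎

  *ₚ-identityˡ : ∀ p → (oneₚ *ₚ p) ≈ₚ p
  *ₚ-identityˡ p = ≈ₚ-trans (+ₚ-cong (scale-1 p) shift-[]) (+ₚ-identityʳ p)

  ℤ[X] : CommutativeRing _ _
  ℤ[X] = record
    { isCommutativeRing = record
      { isRing = record
        { +-isAbelianGroup = record
          { isGroup = record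
            { isMonoid = record
              { isSemigroup = record
                { isMagma = record { isEquivalence = ≈ₚ-isEquivalence ; ∙-cong = +ₚ-cong }
                ; assoc = +ₚ-assoc }
              ; identity = (λ _ → ≈ₚ-refl) , +ₚ-identityʳ }
            ; inverse = -ₚ-inverseˡ , -ₚ-inverseʳ
            ; ⁻¹-cong = -ₚ-cong }
          ; comm = +ₚ-comm }
        ; *-cong = *ₚ-cong
        ; *-assoc = *ₚ-assoc
        ; *-identity = *ₚ-identityˡ , (λ p → ≈ₚ-trans (*ₚ-comm p oneₚ) (*ₚ-identityˡ p))
        ; distrib = *ₚ-distribˡ , (λ p q q′ → *ₚ-distribʳ q q′ p) }
      ; *-comm = *ₚ-comm } }

  ℤ[X]-noTwoTorsion : NoTwoTorsion ℤ[X]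
  ℤ[X]-noTwoTorsion p p+p≈0 = mk λ k → ℤ.*-cancelˡ-≡ (+ 2) _ _ (≡.trans (2*≡+ (coeff p k))
    (≡.trans (≡.trans (≡.sym (coeff-+ₚ p p k)) (coeff-≡ p+p≈0 k)) (≡.sym (ℤ.*-zeroʳ (+ 2)))))
    where
    2*≡+ : ∀ x → + 2 ℤ.* x ≡ x ℤ.+ x
    2*≡+ x = ≡.trans (ℤ.*-distribʳ-+ x (+ 1) (+ 1)) (≡.cong₂ ℤ._+_ (ℤ.*-identityˡ x) (ℤ.*-identityˡ x))

  open Determinant ℤ[X] ℤ[X]-noTwoTorsion
  open import Algebra.Definitions.RawSemiring (Semiring.rawSemiring (CommutativeRing.semiring ℤ[X])) using (_^_)
  open import Algebra.Properties.Semiring.Sum (CommutativeRing.semiring ℤ[X]) using (sum; sum-cong-≋)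
  open import Algebra.Properties.Semiring.Exp (CommutativeRing.semiring ℤ[X]) using (^-homo-*)

  constant : ℕ → Poly
  constant k = + k ∷ []

  constant-+ : ∀ a b → constant (a ℕ.+ b) ≈ₚ (constant a +ₚ constant b)
  constant-+ a b = mk λ { zero → ℤ.pos-+ a b ; (suc k) → ≡.refl }

  constant-* : ∀ a b → constant (a ℕ.* b) ≈ₚ (constant a *ₚ constant b)
  constant-* a b = mk λ
    { zero          → ≡.trans (ℤ.pos-* a b) (≡.sym (ℤ.+-identityʳ _))
    ; (suc zero)    → ≡.refl
    ; (suc (suc k)) → ≡.refl
    }

  constant-Σℕ : ∀ k (f : Fin k → ℕ) → constant (Σℕ k f) ≈ₚ sum (λ i → constant (f i))
  constant-Σℕ zero    f = shift-[]
  constant-Σℕ (suc k) f = ≈ₚ-trans (constant-+ (f zero) _) (+ₚ-cong ≈ₚ-refl (constant-Σℕ k (λ i → f (suc i))))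

  Σₚ≡sum : ∀ k (f : Fin k → Poly) → Σₚ k f ≡ sum f
  Σₚ≡sum zero    f = ≡.refl
  Σₚ≡sum (suc k) f = ≡.cong (f zero +ₚ_) (Σₚ≡sum k (λ i → f (suc i)))

  sgn≡sign : ∀ k p → sgn k p ≡ sign k p
  sgn≡sign zero    p = ≡.refl
  sgn≡sign (suc k) p = ≡.cong -ₚ_ (sgn≡sign k p)

  detₚ≈det : ∀ k (M : Fin k → Fin k → Poly) → detₚ k M ≈ₚ det k M
  detₚ≈det zero    M = ≈ₚ-refl
  detₚ≈det (suc k) M =
    ≈ₚ-trans (≈ₚ-reflexive (Σₚ≡sum (suc k) λ j → sgn (toℕ j) (M zero j *ₚ detₚ k (minor j M))))
      (sum-cong-≋ {suc k} λ j → ≈ₚ-trans (≈ₚ-reflexive (sgn≡sign (toℕ j) _))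
        (sign-cong (toℕ j) (*ₚ-congʳ (M zero j) (detₚ≈det k (minor j M)))))

  charPoly≈characteristic : ∀ k (M : Fin k → Fin k → ℕ) →
    charPoly k M ≈ₚ characteristic k (λ i j → constant (M i j)) Xₚ
  charPoly≈characteristic k M = detₚ≈det k _

  Xₚ^≡Xₚ^ₚ : ∀ k → Xₚ ^ k ≡ Xₚ ^ₚ k
  Xₚ^≡Xₚ^ₚ zero    = ≡.refl
  Xₚ^≡Xₚ^ₚ (suc k) = ≡.cong (Xₚ *ₚ_) (Xₚ^≡Xₚ^ₚ k)

  Xₚ-*ₚ : ∀ p → (Xₚ *ₚ p) ≈ₚ shift p
  Xₚ-*ₚ p = +ₚ-cong (scale-0 p) (∷-cong ≡.refl (*ₚ-identityˡ p))

  Xₚ^-cancelˡ : ∀ j {p q} → ((Xₚ ^ j) *ₚ p) ≈ₚ ((Xₚ ^ j) *ₚ q) → p ≈ₚ q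
  Xₚ^-cancelˡ zero    {p} {q} eq = ≈ₚ-trans (≈ₚ-sym (*ₚ-identityˡ p)) (≈ₚ-trans eq (*ₚ-identityˡ q))
  Xₚ^-cancelˡ (suc j) {p} {q} eq = Xₚ^-cancelˡ j (mk λ k → coeff-≡ shifted (suc k))
    where
    shifted : shift ((Xₚ ^ j) *ₚ p) ≈ₚ shift ((Xₚ ^ j) *ₚ q)
    shifted = begin
      shift ((Xₚ ^ j) *ₚ p)  ≈⟨ ≈ₚ-sym (Xₚ-*ₚ _) ⟩
      Xₚ *ₚ ((Xₚ ^ j) *ₚ p)  ≈⟨ ≈ₚ-sym (*ₚ-assoc Xₚ (Xₚ ^ j) p) ⟩
      (Xₚ ^ suc j) *ₚ p      ≈⟨ eq ⟩
      (Xₚ ^ suc j) *ₚ q      ≈⟨ *ₚ-assoc Xₚ (Xₚ ^ j) q ⟩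
      Xₚ *ₚ ((Xₚ ^ j) *ₚ q)  ≈⟨ Xₚ-*ₚ _ ⟩
      shift ((Xₚ ^ j) *ₚ q)  ∎

  Xₚ^-split : ∀ {a b} → a ℕ.≤ b → (Xₚ ^ b) ≈ₚ ((Xₚ ^ a) *ₚ (Xₚ ^ (b ℕ.∸ a)))
  Xₚ^-split {a} a≤b = ≈ₚ-trans (≈ₚ-reflexive (≡.cong (Xₚ ^_) (≡.sym (ℕ.m+[n∸m]≡n a≤b)))) (^-homo-* Xₚ a _)

  Xₚ^-absorb : ∀ {a b p q} → a ℕ.≤ b → ((Xₚ ^ a) *ₚ p) ≈ₚ ((Xₚ ^ b) *ₚ q) →
    p ≋ ((Xₚ ^ₚ (b ℕ.∸ a)) *ₚ q)
  Xₚ^-absorb {a} {b} {p} {q} a≤b eq = coeff-≡ (Xₚ^-cancelˡ a (begin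
    (Xₚ ^ a) *ₚ p                         ≈⟨ eq ⟩
    (Xₚ ^ b) *ₚ q                         ≈⟨ *ₚ-cong (Xₚ^-split a≤b) ≈ₚ-refl ⟩
    ((Xₚ ^ a) *ₚ (Xₚ ^ (b ℕ.∸ a))) *ₚ q   ≈⟨ *ₚ-assoc (Xₚ ^ a) _ q ⟩
    (Xₚ ^ a) *ₚ ((Xₚ ^ (b ℕ.∸ a)) *ₚ q)
      ≡⟨ ≡.cong (λ r → (Xₚ ^ a) *ₚ (r *ₚ q)) (Xₚ^≡Xₚ^ₚ (b ℕ.∸ a)) ⟩
    (Xₚ ^ a) *ₚ ((Xₚ ^ₚ (b ℕ.∸ a)) *ₚ q)  ∎))

  Xₚ^-balance : ∀ m N {p q} → ((Xₚ ^ m) *ₚ p) ≈ₚ ((Xₚ ^ N) *ₚ q) →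
    Σ ℕ λ k → (p ≋ ((Xₚ ^ₚ k) *ₚ q)) ⊎ (q ≋ ((Xₚ ^ₚ k) *ₚ p))
  Xₚ^-balance m N eq with ℕ.≤-total m N
  ... | inj₁ m≤N = N ℕ.∸ m , inj₁ (Xₚ^-absorb m≤N eq)
  ... | inj₂ N≤m = m ℕ.∸ N , inj₂ (Xₚ^-absorb N≤m (≈ₚ-sym eq))

  charPoly-factorisation : ∀ N m (MN : Fin N → Fin N → ℕ) (Mm : Fin m → Fin m → ℕ)
    (U : Fin N → Fin m → ℕ) (V : Fin m → Fin N → ℕ) →
    (∀ x y → MN x y ≡ Σℕ m (λ J → U x J ℕ.* V J y)) →
    (∀ J I → Mm J I ≡ Σℕ N (λ y → V J y ℕ.* U y I)) →
    Σ ℕ λ k → (charPoly N MN ≋ ((Xₚ ^ₚ k) *ₚ charPoly m Mm))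
            ⊎ (charPoly m Mm ≋ ((Xₚ ^ₚ k) *ₚ charPoly N MN))
  charPoly-factorisation N m MN Mm U V MN≡UV Mm≡VU = Xₚ^-balance m N (begin
    (Xₚ ^ m) *ₚ charPoly N MN                  ≈⟨ *ₚ-congʳ (Xₚ ^ m) (charPoly-product U V MN≡UV) ⟩
    (Xₚ ^ m) *ₚ characteristic N (Uₚ · Vₚ) Xₚ  ≈⟨ sylvester Uₚ Vₚ Xₚ ⟩
    (Xₚ ^ N) *ₚ characteristic m (Vₚ · Uₚ) Xₚ  ≈⟨ *ₚ-congʳ (Xₚ ^ N) (≈ₚ-sym (charPoly-product V U Mm≡VU)) ⟩
    (Xₚ ^ N) *ₚ charPoly m Mm                  ∎)
    where
    Uₚ : Fin N → Fin m → Poly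
    Uₚ x J = constant (U x J)
    Vₚ : Fin m → Fin N → Poly
    Vₚ J y = constant (V J y)
    charPoly-product : ∀ {k l} {M : Fin k → Fin k → ℕ} (P : Fin k → Fin l → ℕ) (Q : Fin l → Fin k → ℕ) →
      (∀ x y → M x y ≡ Σℕ l (λ J → P x J ℕ.* Q J y)) →
      charPoly k M ≈ₚ characteristic k ((λ x J → constant (P x J)) · (λ J y → constant (Q J y))) Xₚ
    charPoly-product {k} {l} {M} P Q M≡PQ = ≈ₚ-trans (charPoly≈characteristic k M) (det-cong k λ x y →
      +ₚ-cong ≈ₚ-refl (-ₚ-cong (≈ₚ-trans (≈ₚ-reflexive (≡.cong constant (M≡PQ x y)))
        (≈ₚ-trans (constant-Σℕ l _) (sum-cong-≋ {l} λ J → constant-* (P x J) (Q J y))))))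

𝟙 : {P : Set} → Dec P → ℕ
𝟙 (yes _) = 1
𝟙 (no _)  = 0

𝟙≤1 : ∀ {P : Set} (P? : Dec P) → 𝟙 P? ≤ 1
𝟙≤1 (yes _) = s≤s z≤n
𝟙≤1 (no _)  = z≤n

𝟙-mono : ∀ {P Q : Set} → (P → Q) → (P? : Dec P) (Q? : Dec Q) → 𝟙 P? ≤ 𝟙 Q?
𝟙-mono _   (no _)  _       = z≤n
𝟙-mono _   (yes _) (yes _) = s≤s z≤n
𝟙-mono P⇒Q (yes p) (no ¬q) = contradiction (P⇒Q p) ¬q

𝟙-< : ∀ {P Q : Set} → ¬ P → Q → (P? : Dec P) (Q? : Dec Q) → 𝟙 P? < 𝟙 Q?
𝟙-< ¬p q (no _)  (yes _) = s≤s z≤n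
𝟙-< ¬p q (yes p) _       = contradiction p ¬p
𝟙-< ¬p q _       (no ¬q) = contradiction q ¬q

module FiniteReachability {X : Set} (_≟_ : DecidableEquality X) (_⟶_ : X → X → Set)
  (successors : ∀ x → List (∃ (x ⟶_)))
  (successors-complete : ∀ {x y} → x ⟶ y → Any (λ s → proj₁ s ≡ y) (successors x))
  (Q : X → Set) (Q-closed : ∀ {x y} → x ⟶ y → Q x → Q y)
  (universe : List X) (universe-complete : ∀ {x} → Q x → x ∈ₗ universe) where

  open import Data.List.Base using ([]; _∷_; [_]; length)
  open import Data.List.Membership.Propositional using (_∈_; _∉_; find)
  open import Data.List.Relation.Unary.Any as Any using (here; there; any?)
  open import Data.Nat.Base as ℕ using (suc)
  import Data.Nat.Properties as ℕ
  open import Data.Product.Base using (_×_; _,_; proj₂)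
  open import Function.Base using (_∘_)
  open import Relation.Binary.Construct.Closure.ReflexiveTransitive using (Star; ε; _◅_; _◅◅_)
  open import Relation.Binary.PropositionalEquality using (refl)
  open import Relation.Nullary using (¬?)
  open import Relation.Nullary.Decidable using (decidable-stable)

  open import Data.List.Membership.DecPropositional _≟_ using (_∈?_)

  unexplored : List X → List X → ℕ
  unexplored S []      = 0
  unexplored S (u ∷ U) = 𝟙 (¬? (u ∈? S)) ℕ.+ unexplored S U

  unexplored-bound : ∀ S U → unexplored S U ≤ length U
  unexplored-bound S []      = z≤n
  unexplored-bound S (u ∷ U) = ℕ.+-mono-≤ (𝟙≤1 (¬? (u ∈? S))) (unexplored-bound S U)

  unexplored-≤ : ∀ v S U → unexplored (v ∷ S) U ≤ unexplored S U
  unexplored-≤ v S []      = z≤n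
  unexplored-≤ v S (u ∷ U) = ℕ.+-mono-≤ (𝟙-mono (_∘ there) (¬? (u ∈? (v ∷ S))) (¬? (u ∈? S))) (unexplored-≤ v S U)

  unexplored-< : ∀ v S U → v ∈ U → v ∉ S → unexplored (v ∷ S) U < unexplored S U
  unexplored-< v S (u ∷ U) (here refl) v∉S =
    ℕ.+-mono-<-≤ (𝟙-< (λ v∉v∷S → v∉v∷S (here refl)) v∉S (¬? (v ∈? (v ∷ S))) (¬? (v ∈? S))) (unexplored-≤ v S U)
  unexplored-< v S (u ∷ U) (there v∈U) v∉S =
    ℕ.+-mono-≤-< (𝟙-mono (_∘ there) (¬? (u ∈? (v ∷ S))) (¬? (u ∈? S))) (unexplored-< v S U v∈U v∉S)

  module _ (x : X) (Qx : Q x) where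

    Explored : List X → Set
    Explored S = (∀ {y} → y ∈ S → Star _⟶_ x y × Q y) × x ∈ S

    Closed : List X → Set
    Closed S = ∀ {y} → y ∈ S → ∀ {z} → y ⟶ z → z ∈ S

    Escape : List X → Set
    Escape S = Any (λ y → Any (λ s → proj₁ s ∉ S) (successors y)) S

    closed : ∀ S → ¬ Escape S → Closed S
    closed S no-escape {y} y∈S {z} y⟶z = decidable-stable (z ∈? S) λ z∉S →
      no-escape (Any.map (λ { refl → Any.map (λ { refl → z∉S }) (successors-complete y⟶z) }) y∈S)

    search : ∀ fuel S → unexplored S universe < fuel → Explored S → ∃ λ S′ → Explored S′ × Closed S′
    search (suc fuel) S bound explored with any? (λ y → any? (λ s → ¬? (proj₁ s ∈? S)) (successors y)) S
    ... | no no-escape = S , explored , closed S no-escape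
    ... | yes escape with find escape
    ...   | y , y∈S , new with find new
    ...     | (z , y⟶z) , _ , z∉S = search fuel (z ∷ S) bound′ explored′
      where
      Qz : Q z
      Qz = Q-closed y⟶z (proj₂ (proj₁ explored y∈S))
      bound′ : unexplored (z ∷ S) universe < fuel
      bound′ = ℕ.<-≤-trans (unexplored-< z S universe (universe-complete Qz) z∉S) (ℕ.s≤s⁻¹ bound)
      explored′ : Explored (z ∷ S)
      explored′ = (λ { (here refl) → proj₁ (proj₁ explored y∈S) ◅◅ (y⟶z ◅ ε) , Qz
                     ; (there p)   → proj₁ explored p })
                , there (proj₂ explored)

    reachableSet : ∃ λ S → Explored S × Closed S
    reachableSet = search (suc (length universe)) [ x ] (s≤s (unexplored-bound [ x ] universe))
      ((λ { (here refl) → ε , Qx }) , here refl)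


    reachable? : ∀ y → Dec (Star _⟶_ x y)
    reachable? y with reachableSet
    ... | S , (sound , x∈S) , closedS with y ∈? S
    ...   | yes y∈S = yes (proj₁ (sound y∈S))
    ...   | no y∉S  = no λ x⟶*y → y∉S (stays x∈S x⟶*y)
      where
      stays : ∀ {a b} → a ∈ S → Star _⟶_ a b → b ∈ S
      stays a∈S ε          = a∈S
      stays a∈S (a⟶c ◅ c⟶*b) = stays (closedS a∈S a⟶c) c⟶*b

open import Defs
import Data.Bool.Properties as Bool
open import Data.Fin.Base using (Fin; zero; suc; toℕ; _↑ˡ_; _↑ʳ_; splitAt)
import Data.Fin.Properties as Fin
open import Data.Fin.Properties using (splitAt-↑ˡ; splitAt-↑ʳ; splitAt⁻¹-↑ˡ; splitAt⁻¹-↑ʳ; injective⇒≤)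
open import Data.Fin.Subset using (Subset; _∈_)
import Data.Fin.Subset.Properties as Subset
open import Data.List.Base using ([]; _∷_; _++_; _∷ʳ_; [_]; length; map; upTo; cartesianProductWith)
open import Data.List.Properties using (length-++; ++-assoc; ≡-dec)
open import Data.List.Relation.Unary.All as All using (All; []; _∷_; all?)
import Data.List.Relation.Unary.All.Properties as All
open import Data.List.Relation.Unary.Any as Any using (here; any?)
import Data.List.Relation.Unary.Any.Properties as Any
open import Data.List.Membership.Propositional using (find; lose)
open import Data.List.Membership.Propositional.Properties using (∈-upTo⁺; ∈-cartesianProductWith⁺)
open import Data.Nat.Base as ℕ using (zero; suc; _≥_; _∸_)
import Data.Nat.Properties as ℕ
open import Data.Product.Base using (Σ; _×_; _,_; proj₂)
open import Data.Sum.Base using (_⊎_; inj₁; inj₂)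
open import Data.Vec.Base as Vec using (Vec; []; _∷_; tabulate; toList)
import Data.Vec.Properties as Vec
import Data.Vec.Relation.Unary.All as VAll
open import Data.Vec.Relation.Binary.Pointwise.Inductive using (Pointwise; []; _∷_)
open import Function.Base using (_∘_)
open import Function.Bundles using (_⇔_; mk⇔; Equivalence)
open import Function.Definitions using (Bijective)
open import Function.Properties.Equivalence using (⇔-isEquivalence)
import Relation.Binary.Construct.Closure.Equivalence as EqClosure
open import Relation.Binary.Construct.Closure.ReflexiveTransitive using (ε; _◅◅_)
open import Relation.Binary.Construct.Closure.Symmetric as Sym using (SymClosure; fwd; bwd)
open import Relation.Binary.PropositionalEquality as ≡ using (_≢_; refl)
open import Relation.Nullary using (does; proof)
open import Relation.Nullary.Decidable using (_×-dec_; _→-dec_; dec-true; map′)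
open import Relation.Nullary.Reflects using (Reflects; invert)

-- Equivalence of positive braid words

≈-sym : ∀ {x y} → x ≈ y → y ≈ x
≈-sym = EqClosure.symmetric Step

≈-trans : ∀ {x y z} → x ≈ y → y ≈ z → x ≈ z
≈-trans = _◅◅_

length-step : ∀ {x y} → Step x y → length x ≡ length y
length-step (comm u v i j _) = ≡.trans (length-++ u) (≡.sym (length-++ u))
length-step (braid u v i)    = ≡.trans (length-++ u) (≡.sym (length-++ u))

length-≈ : ∀ {x y} → x ≈ y → length x ≡ length y
length-≈ = EqClosure.gfold ≡.isEquivalence length length-step

All-step : ∀ {P : ℕ → Set} {x y} → Step x y → All P x ⇔ All P y
All-step {P} (comm u v i j _) = mk⇔ (swap i j) (swap j i)
  where
  swap : ∀ a b → All P (u ++ a ∷ b ∷ v) → All P (u ++ b ∷ a ∷ v)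
  swap a b Pw with All.++⁻ u Pw
  ... | Pu , Pa ∷ Pb ∷ Pv = All.++⁺ Pu (Pb ∷ Pa ∷ Pv)
All-step {P} (braid u v i) = mk⇔ rotate rotate
  where
  rotate : ∀ {a b} → All P (u ++ a ∷ b ∷ a ∷ v) → All P (u ++ b ∷ a ∷ b ∷ v)
  rotate Pw with All.++⁻ u Pw
  ... | Pu , Pa ∷ Pb ∷ _ ∷ Pv = All.++⁺ Pu (Pb ∷ Pa ∷ Pb ∷ Pv)

All-≈ : ∀ {P : ℕ → Set} {x y} → x ≈ y → All P x → All P y
All-≈ {P} x≈y = Equivalence.to (EqClosure.gfold ⇔-isEquivalence (All P) All-step x≈y)

step-++ʳ : ∀ z {x y} → Step x y → Step (x ++ z) (y ++ z)
step-++ʳ z (comm u v i j i+2≤j) = ≡.subst₂ Step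
  (≡.sym (++-assoc u (i ∷ j ∷ v) z)) (≡.sym (++-assoc u (j ∷ i ∷ v) z)) (comm u (v ++ z) i j i+2≤j)
step-++ʳ z (braid u v i) = ≡.subst₂ Step
  (≡.sym (++-assoc u (i ∷ suc i ∷ i ∷ v) z)) (≡.sym (++-assoc u (suc i ∷ i ∷ suc i ∷ v) z)) (braid u (v ++ z) i)

≈-++ʳ : ∀ z {x y} → x ≈ y → (x ++ z) ≈ (y ++ z)
≈-++ʳ z = EqClosure.gmap (_++ z) (step-++ʳ z)

Simple-resp-≈ : ∀ {n x y} → Simple n x → x ≈ y → Simple n y
Simple-resp-≈ (wx , z , wz , xz≈Δ) x≈y = All-≈ x≈y wx , z , wz , ≈-trans (≈-++ʳ z (≈-sym x≈y)) xz≈Δ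

Move : List ℕ → Set
Move w = ∃ (SymClosure Step w)

commuteMoves : ∀ w → List (Move w)
commuteMoves (i ∷ j ∷ v) with 2 ℕ.+ i ℕ.≤? j | 2 ℕ.+ j ℕ.≤? i
... | yes i+2≤j | _         = [ j ∷ i ∷ v , fwd (comm [] v i j i+2≤j) ]
... | no _      | yes j+2≤i = [ j ∷ i ∷ v , bwd (comm [] v j i j+2≤i) ]
... | no _      | no _      = []
commuteMoves _ = []

braidMoves : ∀ w → List (Move w)
braidMoves (i ∷ j ∷ k ∷ v) with j ℕ.≟ suc i | k ℕ.≟ i
... | yes refl | yes refl = [ suc i ∷ i ∷ suc i ∷ v , fwd (braid [] v i) ]
... | _        | _        = []
braidMoves _ = []

unbraidMoves : ∀ w → List (Move w)
unbraidMoves (i ∷ j ∷ k ∷ v) with i ℕ.≟ suc j | k ℕ.≟ i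
... | yes refl | yes refl = [ j ∷ suc j ∷ j ∷ v , bwd (braid [] v j) ]
... | _        | _        = []
unbraidMoves _ = []

step-∷ : ∀ a {x y} → Step x y → Step (a ∷ x) (a ∷ y)
step-∷ a (comm u v i j i+2≤j) = comm (a ∷ u) v i j i+2≤j
step-∷ a (braid u v i)        = braid (a ∷ u) v i

move-∷ : ∀ a {w} → Move w → Move (a ∷ w)
move-∷ a (v , s) = a ∷ v , Sym.gmap (a ∷_) (step-∷ a) s

moves : ∀ w → List (Move w)
moves []      = []
moves (a ∷ w) = (commuteMoves (a ∷ w) ++ braidMoves (a ∷ w) ++ unbraidMoves (a ∷ w)) ++ map (move-∷ a) (moves w)

Reaches : ∀ {w} → List ℕ → Move w → Set
Reaches y m = proj₁ m ≡ y

module _ {a : ℕ} {w y : List ℕ} where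

  commuteMove∈ : Any (Reaches y) (commuteMoves (a ∷ w)) → Any (Reaches y) (moves (a ∷ w))
  commuteMove∈ = Any.++⁺ˡ ∘ Any.++⁺ˡ

  braidMove∈ : Any (Reaches y) (braidMoves (a ∷ w)) → Any (Reaches y) (moves (a ∷ w))
  braidMove∈ = Any.++⁺ˡ ∘ Any.++⁺ʳ (commuteMoves (a ∷ w)) ∘ Any.++⁺ˡ

  unbraidMove∈ : Any (Reaches y) (unbraidMoves (a ∷ w)) → Any (Reaches y) (moves (a ∷ w))
  unbraidMove∈ = Any.++⁺ˡ ∘ Any.++⁺ʳ (commuteMoves (a ∷ w)) ∘ Any.++⁺ʳ (braidMoves (a ∷ w))

  innerMove∈ : Any (Reaches y) (moves w) → Any (Reaches (a ∷ y)) (moves (a ∷ w))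
  innerMove∈ = Any.++⁺ʳ _ ∘ Any.map⁺ ∘ Any.map (≡.cong (a ∷_))

commute-fwd : ∀ i j v → 2 ℕ.+ i ≤ j → Any (Reaches (j ∷ i ∷ v)) (commuteMoves (i ∷ j ∷ v))
commute-fwd i j v i+2≤j with 2 ℕ.+ i ℕ.≤? j
... | yes _     = here refl
... | no i+2≰j  = contradiction i+2≤j i+2≰j

commute-bwd : ∀ i j v → 2 ℕ.+ i ≤ j → Any (Reaches (i ∷ j ∷ v)) (commuteMoves (j ∷ i ∷ v))
commute-bwd i j v i+2≤j with 2 ℕ.+ j ℕ.≤? i | 2 ℕ.+ i ℕ.≤? j
... | yes j+2≤i | _        = contradiction (ℕ.≤-trans (ℕ.n≤1+n _) j+2≤i) (ℕ.<-asym (ℕ.≤-trans (ℕ.n≤1+n _) i+2≤j))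
... | no _      | yes _    = here refl
... | no _      | no i+2≰j = contradiction i+2≤j i+2≰j

braid-fwd : ∀ i v → Any (Reaches (suc i ∷ i ∷ suc i ∷ v)) (braidMoves (i ∷ suc i ∷ i ∷ v))
braid-fwd i v with suc i ℕ.≟ suc i | i ℕ.≟ i
... | yes refl | yes refl = here refl
... | no i≢i   | _        = contradiction refl i≢i
... | yes refl | no i≢i   = contradiction refl i≢i

braid-bwd : ∀ i v → Any (Reaches (i ∷ suc i ∷ i ∷ v)) (unbraidMoves (suc i ∷ i ∷ suc i ∷ v))
braid-bwd i v with suc i ℕ.≟ suc i | suc i ℕ.≟ suc i
... | yes refl | yes refl = here refl
... | no i≢i   | _        = contradiction refl i≢i
... | yes refl | no i≢i   = contradiction refl i≢i

moves-complete-fwd : ∀ {x y} → Step x y → Any (Reaches y) (moves x)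
moves-complete-fwd (comm []      v i j i+2≤j) = commuteMove∈ (commute-fwd i j v i+2≤j)
moves-complete-fwd (comm (a ∷ u) v i j i+2≤j) = innerMove∈ (moves-complete-fwd (comm u v i j i+2≤j))
moves-complete-fwd (braid []      v i)        = braidMove∈ (braid-fwd i v)
moves-complete-fwd (braid (a ∷ u) v i)        = innerMove∈ (moves-complete-fwd (braid u v i))

moves-complete-bwd : ∀ {x y} → Step y x → Any (Reaches y) (moves x)
moves-complete-bwd (comm []      v i j i+2≤j) = commuteMove∈ (commute-bwd i j v i+2≤j)
moves-complete-bwd (comm (a ∷ u) v i j i+2≤j) = innerMove∈ (moves-complete-bwd (comm u v i j i+2≤j))
moves-complete-bwd (braid []      v i)        = unbraidMove∈ (braid-bwd i v)
moves-complete-bwd (braid (a ∷ u) v i)        = innerMove∈ (moves-complete-bwd (braid u v i))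

moves-complete : ∀ {x y} → SymClosure Step x y → Any (Reaches y) (moves x)
moves-complete (fwd s) = moves-complete-fwd s
moves-complete (bwd s) = moves-complete-bwd s

words : ℕ → List ℕ → List (List ℕ)
words zero    letters = [ [] ]
words (suc L) letters = cartesianProductWith _∷_ letters (words L letters)

words-complete : ∀ {letters} L w → length w ≡ L → All (_∈ₗ letters) w → w ∈ₗ words L letters
words-complete zero    []      _   []          = here refl
words-complete (suc L) (a ∷ w) len (a∈ ∷ w∈) =
  ∈-cartesianProductWith⁺ _∷_ a∈ (words-complete L w (ℕ.suc-injective len) w∈)

IsWord⇒letters : ∀ n {w} → IsWord n w → All (_∈ₗ upTo n) w
IsWord⇒letters n = All.map λ {i} 1+i<n → ∈-upTo⁺ (ℕ.<-trans (ℕ.n<1+n i) 1+i<n)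

isWord? : ∀ n w → Dec (IsWord n w)
isWord? n = all? λ i → suc i ℕ.<? n

-- Relations preserve length and letters, so the class of x lies among the words of length |x| over {0,…,n-1}.
_≈?_ : ∀ {n x} → IsWord n x → ∀ y → Dec (x ≈ y)
_≈?_ {n} {x} wx = FiniteReachability.reachable? (≡-dec ℕ._≟_) (SymClosure Step) moves moves-complete
  SameShape SameShape-closed (words (length x) (upTo n)) (λ {w} → SameShape⇒word w) x (refl , wx)
  where
  SameShape : List ℕ → Set
  SameShape w = length w ≡ length x × IsWord n w
  SameShape-closed : ∀ {v w} → SymClosure Step v w → SameShape v → SameShape w
  SameShape-closed (fwd s) (len , wv) = ≡.trans (≡.sym (length-step s)) len , Equivalence.to (All-step s) wv
  SameShape-closed (bwd s) (len , wv) = ≡.trans (length-step s) len , Equivalence.from (All-step s) wv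
  SameShape⇒word : ∀ w → SameShape w → w ∈ₗ words (length x) (upTo n)
  SameShape⇒word w (len , ww) = words-complete (length x) w len (IsWord⇒letters n ww)

searchWords : ∀ n L (P : List ℕ → Set) → (∀ z → Dec (P z)) → (∀ {z} → P z → length z ≡ L) →
  Dec (Σ (List ℕ) λ z → IsWord n z × P z)
searchWords n L P P? P⇒length with any? (λ z → isWord? n z ×-dec P? z) (words L (upTo n))
... | yes found = let z , _ , wz , Pz = find found in yes (z , wz , Pz)
... | no none   = no λ (z , wz , Pz) → none (lose (words-complete L z (P⇒length Pz) (IsWord⇒letters n wz)) (wz , Pz))

σ-leftDivides? : ∀ n {k} (i : Fin k) {x} → IsWord n x → Dec (LDiv n (σ i) x)
σ-leftDivides? n i {x} wx = searchWords n (length x ∸ 1) (λ z → (toℕ i ∷ z) ≈ x)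
  (λ z → map′ ≈-sym ≈-sym (wx ≈? (toℕ i ∷ z))) (≡.cong (_∸ 1) ∘ length-≈)

σ-rightDivides? : ∀ n {k} (i : Fin k) {x} → IsWord n x → Dec (RDiv n (σ i) x)
σ-rightDivides? n i {x} wx = searchWords n (length x ∸ 1) (λ z → (z ++ σ i) ≈ x)
  (λ z → map′ ≈-sym ≈-sym (wx ≈? (z ++ σ i)))
  (λ {z} e → ≡.trans (≡.sym (ℕ.m+n∸n≡m (length z) 1)) (≡.cong (_∸ 1) (≡.trans (≡.sym (length-++ z)) (length-≈ e))))

module Descents (n : ℕ) where

  LDiv-resp-≈ : ∀ {s x x′} → LDiv n s x → x ≈ x′ → LDiv n s x′
  LDiv-resp-≈ (z , wz , sz≈x) x≈x′ = z , wz , ≈-trans sz≈x x≈x′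

  RDiv-resp-≈ : ∀ {s x x′} → RDiv n s x → x ≈ x′ → RDiv n s x′
  RDiv-resp-≈ (z , wz , zs≈x) x≈x′ = z , wz , ≈-trans zs≈x x≈x′

  DL≡-resp-≈ : ∀ {x x′ I} → DL≡ n x I → x ≈ x′ → DL≡ n x′ I
  DL≡-resp-≈ DLx x≈x′ i = (λ i∈I → LDiv-resp-≈ (proj₁ (DLx i) i∈I) x≈x′)
                         , (λ σi∣x′ → proj₂ (DLx i) (LDiv-resp-≈ σi∣x′ (≈-sym x≈x′)))

  DR⊇-resp-≈ : ∀ {x x′ J} → DR⊇ n x J → x ≈ x′ → DR⊇ n x′ J
  DR⊇-resp-≈ DRx x≈x′ i i∈J = RDiv-resp-≈ (DRx i i∈J) x≈x′

  DL≡-unique : ∀ {x I I′} → DL≡ n x I → DL≡ n x I′ → I ≡ I′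
  DL≡-unique DLx DLx′ = Subset.⊆-antisym (λ {i} i∈I → proj₂ (DLx′ i) (proj₁ (DLx i) i∈I))
                                         (λ {i} i∈I′ → proj₂ (DLx i) (proj₁ (DLx′ i) i∈I′))

  leftDescents : ∀ {x} → IsWord n x → Subset (n ∸ 1)
  leftDescents wx = tabulate λ i → does (σ-leftDivides? n i wx)

  leftDescents-DL≡ : ∀ {x} (wx : IsWord n x) → DL≡ n x (leftDescents wx)
  leftDescents-DL≡ wx i =
    (λ i∈ → invert (≡.subst (Reflects _) (≡.trans (≡.sym (Vec.lookup∘tabulate _ i)) (Vec.[]=⇒lookup i∈))
                             (proof (σ-leftDivides? n i wx)))) ,
    (λ σi∣x → Vec.lookup⇒[]= i _ (≡.trans (Vec.lookup∘tabulate _ i) (dec-true (σ-leftDivides? n i wx) σi∣x)))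

  DR⊇? : ∀ {x} → IsWord n x → ∀ J → Dec (DR⊇ n x J)
  DR⊇? wx J = Fin.all? λ i → (i Subset.∈? J) →-dec σ-rightDivides? n i wx

  NormalPair⇒DR⊇ : ∀ {x y I} → NormalPair n x y → DL≡ n y I → DR⊇ n x I
  NormalPair⇒DR⊇ xy DLy i i∈I = xy i (proj₁ (DLy i) i∈I)

  DR⊇⇒NormalPair : ∀ {x y I} → DR⊇ n x I → DL≡ n y I → NormalPair n x y
  DR⊇⇒NormalPair DRx DLy i σi∣y = DRx i (proj₂ (DLy i) σi∣y)

module _ {P : List ℕ → Set} where

  All-∷ʳ⁺ : ∀ {k} {ys : Vec (List ℕ) k} {x} → VAll.All P ys → P x → VAll.All P (ys Vec.∷ʳ x)
  All-∷ʳ⁺ VAll.[]         Px = Px VAll.∷ VAll.[]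
  All-∷ʳ⁺ (Py VAll.∷ Pys) Px = Py VAll.∷ All-∷ʳ⁺ Pys Px

  All-∷ʳ⁻ : ∀ {k} (ys : Vec (List ℕ) k) {x} → VAll.All P (ys Vec.∷ʳ x) → VAll.All P ys × P x
  All-∷ʳ⁻ []       (Px VAll.∷ VAll.[]) = VAll.[] , Px
  All-∷ʳ⁻ (y ∷ ys) (Py VAll.∷ Pys)     = let Pys′ , Px = All-∷ʳ⁻ ys Pys in Py VAll.∷ Pys′ , Px

module _ {R : List ℕ → List ℕ → Set} where

  Pointwise-∷ʳ⁺ : ∀ {k} {xs ys : Vec (List ℕ) k} {x y} →
    Pointwise R xs ys → R x y → Pointwise R (xs Vec.∷ʳ x) (ys Vec.∷ʳ y)
  Pointwise-∷ʳ⁺ []          Rxy = Rxy ∷ []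
  Pointwise-∷ʳ⁺ (Rx ∷ Rxs) Rxy = Rx ∷ Pointwise-∷ʳ⁺ Rxs Rxy

  Pointwise-∷ʳ⁻ : ∀ {k} (xs ys : Vec (List ℕ) k) {x y} →
    Pointwise R (xs Vec.∷ʳ x) (ys Vec.∷ʳ y) → Pointwise R xs ys × R x y
  Pointwise-∷ʳ⁻ []       []       (Rxy ∷ [])  = [] , Rxy
  Pointwise-∷ʳ⁻ (x ∷ xs) (y ∷ ys) (Rx ∷ Rxs) = let Rxs′ , Rxy = Pointwise-∷ʳ⁻ xs ys Rxs in Rx ∷ Rxs′ , Rxy

  Pointwise-last : ∀ {k} {xs ys : Vec (List ℕ) (suc k)} → Pointwise R xs ys → R (Vec.last xs) (Vec.last ys)
  Pointwise-last {xs = xs} {ys} Rxs with Vec.initLast xs | Vec.initLast ys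
  ... | xs′ , x , refl | ys′ , y , refl = proj₂ (Pointwise-∷ʳ⁻ xs′ ys′ Rxs)

module NormalSequences (n : ℕ) where

  open Descents n

  NormalSeq-∷ʳ⁻ : ∀ l x y → NormalSeq n ((l ∷ʳ x) ∷ʳ y) → NormalSeq n (l ∷ʳ x) × NormalPair n x y
  NormalSeq-∷ʳ⁻ []          x y (xy , _)      = _ , xy
  NormalSeq-∷ʳ⁻ (a ∷ [])    x y (ax , xy , _) = (ax , _) , xy
  NormalSeq-∷ʳ⁻ (a ∷ b ∷ l) x y (ab , rest)   = let rest′ , xy = NormalSeq-∷ʳ⁻ (b ∷ l) x y rest in (ab , rest′) , xy

  NormalSeq-∷ʳ⁺ : ∀ l x y → NormalSeq n (l ∷ʳ x) → NormalPair n x y → NormalSeq n ((l ∷ʳ x) ∷ʳ y)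
  NormalSeq-∷ʳ⁺ []          x y _           xy = xy , _
  NormalSeq-∷ʳ⁺ (a ∷ [])    x y (ax , _)    xy = ax , xy , _
  NormalSeq-∷ʳ⁺ (a ∷ b ∷ l) x y (ab , rest) xy = ab , NormalSeq-∷ʳ⁺ (b ∷ l) x y rest xy

  NormalSeq-resp-≈ : ∀ l {x x′} → NormalSeq n (l ∷ʳ x) → x ≈ x′ → NormalSeq n (l ∷ʳ x′)
  NormalSeq-resp-≈ []          _        _    = _
  NormalSeq-resp-≈ (a ∷ [])    (ax , _) x≈x′ = (λ i σi∣x′ → ax i (LDiv-resp-≈ σi∣x′ (≈-sym x≈x′))) , _
  NormalSeq-resp-≈ (a ∷ b ∷ l) (ab , rest) x≈x′ = ab , NormalSeq-resp-≈ (b ∷ l) rest x≈x′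

-- Counting up to an equivalence

Σℕ-cong : ∀ m {f g : Fin m → ℕ} → (∀ i → f i ≡ g i) → Σℕ m f ≡ Σℕ m g
Σℕ-cong zero    f≡g = refl
Σℕ-cong (suc m) f≡g = ≡.cong₂ ℕ._+_ (f≡g zero) (Σℕ-cong m (λ i → f≡g (suc i)))

Σℕ-const : ∀ m b → Σℕ m (λ _ → b) ≡ m ℕ.* b
Σℕ-const zero    b = refl
Σℕ-const (suc m) b = ≡.cong (b ℕ.+_) (Σℕ-const m b)

Σℕ-single : ∀ m (f : Fin m → ℕ) a → (∀ i → i ≢ a → f i ≡ 0) → Σℕ m f ≡ f a
Σℕ-single (suc m) f zero    f≡0 = ≡.trans (≡.cong (f zero ℕ.+_) (Σℕ-zero m λ i → f≡0 (suc i) λ ())) (ℕ.+-identityʳ _)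
  where
  Σℕ-zero : ∀ m {g : Fin m → ℕ} → (∀ i → g i ≡ 0) → Σℕ m g ≡ 0
  Σℕ-zero m g≡0 = ≡.trans (Σℕ-cong m g≡0) (≡.trans (Σℕ-const m 0) (ℕ.*-zeroʳ m))
Σℕ-single (suc m) f (suc a) f≡0 = ≡.trans (≡.cong (ℕ._+ Σℕ m (λ i → f (suc i))) (f≡0 zero λ ()))
  (Σℕ-single m (λ i → f (suc i)) a λ i i≢a → f≡0 (suc i) λ { refl → i≢a refl })

Σℕ-join : ∀ m (f : Fin m → ℕ) → Σ (Fin m) (Fin ∘ f) → Fin (Σℕ m f)
Σℕ-join (suc m) f (zero  , k) = k ↑ˡ Σℕ m (f ∘ suc)
Σℕ-join (suc m) f (suc a , k) = f zero ↑ʳ Σℕ-join m (f ∘ suc) (a , k)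

Σℕ-split : ∀ m (f : Fin m → ℕ) → Fin (Σℕ m f) → Σ (Fin m) (Fin ∘ f)
Σℕ-split (suc m) f i with splitAt (f zero) i
... | inj₁ k = zero , k
... | inj₂ j = let a , k = Σℕ-split m (f ∘ suc) j in suc a , k

Σℕ-split-join : ∀ m f p → Σℕ-split m f (Σℕ-join m f p) ≡ p
Σℕ-split-join (suc m) f (zero , k)
  rewrite splitAt-↑ˡ (f zero) k (Σℕ m (f ∘ suc)) = refl
Σℕ-split-join (suc m) f (suc a , k)
  rewrite splitAt-↑ʳ (f zero) (Σℕ m (f ∘ suc)) (Σℕ-join m (f ∘ suc) (a , k))
        | Σℕ-split-join m (f ∘ suc) (a , k) = refl

Σℕ-join-split : ∀ m f i → Σℕ-join m f (Σℕ-split m f i) ≡ i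
Σℕ-join-split (suc m) f i with splitAt (f zero) i in eq
... | inj₁ k = splitAt⁻¹-↑ˡ eq
... | inj₂ j = ≡.trans (≡.cong (f zero ↑ʳ_) (Σℕ-join-split m (f ∘ suc) j)) (splitAt⁻¹-↑ʳ eq)

Σℕ-split-injective : ∀ m f {i j} → Σℕ-split m f i ≡ Σℕ-split m f j → i ≡ j
Σℕ-split-injective m f {i} {j} eq =
  ≡.trans (≡.sym (Σℕ-join-split m f i)) (≡.trans (≡.cong (Σℕ-join m f) eq) (Σℕ-join-split m f j))

module _ {X : Set} {_∼_ : X → X → Set} where

  HasCount-Σ : ∀ {P : X → Set} {m} (Q : Fin m → X → Set) (f : Fin m → ℕ) →
    (∀ a → HasCount _∼_ (Q a) (f a)) →
    (∀ {a x} → Q a x → P x) →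
    (∀ {x} → P x → ∃ λ a → Q a x) →
    (∀ {a b x y} → Q a x → Q b y → x ∼ y → a ≡ b) →
    HasCount _∼_ P (Σℕ m f)
  HasCount-Σ {P} {m} Q f count Q⇒P P⇒Q disjoint = enum , enum-P , enum-injective , enum-surjective
    where
    enumᵃ : ∀ a → Fin (f a) → X
    enumᵃ a = proj₁ (count a)
    enum : Fin (Σℕ m f) → X
    enum i = let a , k = Σℕ-split m f i in enumᵃ a k
    enum-P : ∀ i → P (enum i)
    enum-P i = let a , k = Σℕ-split m f i in Q⇒P (proj₁ (proj₂ (count a)) k)
    enum-injective : ∀ i j → enum i ∼ enum j → i ≡ j
    enum-injective i j ei∼ej = Σℕ-split-injective m f (same (Σℕ-split m f i) (Σℕ-split m f j) ei∼ej)
      where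
      same : ∀ p q → enumᵃ (proj₁ p) (proj₂ p) ∼ enumᵃ (proj₁ q) (proj₂ q) → p ≡ q
      same (a , k) (b , l) e∼e with disjoint (proj₁ (proj₂ (count a)) k) (proj₁ (proj₂ (count b)) l) e∼e
      ... | refl = ≡.cong (a ,_) (proj₁ (proj₂ (proj₂ (count a))) k l e∼e)
    enum-surjective : ∀ x → P x → ∃ λ i → x ∼ enum i
    enum-surjective x Px = let a , Qax = P⇒Q Px ; k , x∼e = proj₂ (proj₂ (proj₂ (count a))) x Qax in
      Σℕ-join m f (a , k) , ≡.subst (λ p → x ∼ enumᵃ (proj₁ p) (proj₂ p)) (≡.sym (Σℕ-split-join m f (a , k))) x∼e

  HasCount-indicator : ∀ {x₀ : X} {C : Set} → (∀ {x} → x ∼ x) → (C? : Dec C) →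
    HasCount _∼_ (λ x → x ∼ x₀ × C) (𝟙 C?)
  HasCount-indicator {x₀} ∼-refl (yes c) =
    (λ _ → x₀) , (λ _ → ∼-refl , c) , (λ { zero zero _ → refl }) , λ x (x∼x₀ , _) → zero , x∼x₀
  HasCount-indicator {x₀} ∼-refl (no ¬c) = (λ ()) , (λ ()) , (λ ()) , λ x (_ , c) → contradiction c ¬c

  HasCount-unique : ∀ {P : X → Set} → (∀ {x y} → x ∼ y → y ∼ x) → (∀ {x y z} → x ∼ y → y ∼ z → x ∼ z) →
    ∀ {k l} → HasCount _∼_ P k → HasCount _∼_ P l → k ≡ l
  HasCount-unique {P} ∼-sym ∼-trans c c′ = ℕ.≤-antisym (≤-count c c′) (≤-count c′ c)
    where
    ≤-count : ∀ {k l} → HasCount _∼_ P k → HasCount _∼_ P l → k ℕ.≤ l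
    ≤-count {k} {l} (e , Pe , e-inj , _) (e′ , _ , _ , e′-sur) = injective⇒≤ {f = index} λ {a} {b} same →
      e-inj a b (∼-trans (≡.subst (λ i → e a ∼ e′ i) same (proj₂ (e′-sur (e a) (Pe a))))
                         (∼-sym (proj₂ (e′-sur (e b) (Pe b)))))
      where
      index : Fin k → Fin l
      index a = proj₁ (e′-sur (e a) (Pe a))

𝟙-× : ∀ {P Q : Set} (P? : Dec P) (Q? : Dec Q) → 𝟙 P? ℕ.* 𝟙 Q? ≡ 𝟙 (P? ×-dec Q?)
𝟙-× (yes _) (yes _) = refl
𝟙-× (yes _) (no _)  = refl
𝟙-× (no _)  _       = refl

module NormalFormCounting (n m : ℕ) (e : Fin m → Subset (n ∸ 1)) (e-bijective : Bijective _≡_ _≡_ e)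
  (A : Subset (n ∸ 1) → Subset (n ∸ 1) → ℕ) (A-counts : ∀ I J → IsA n I J (A I J)) where

  open Descents n
  open NormalSequences n

  e-injective : ∀ {a b} → e a ≡ e b → a ≡ b
  e-injective = proj₁ e-bijective

  index : Subset (n ∸ 1) → Fin m
  index I = proj₁ (proj₂ e-bijective I)

  e-index : ∀ I → e (index I) ≡ I
  e-index I = proj₂ (proj₂ e-bijective I) refl

  M′ : Fin m → Fin m → ℕ
  M′ a b = A (e a) (e b)

  factor : ∀ a c → Fin (A (e a) (e c)) → List ℕ
  factor a c = proj₁ (A-counts (e a) (e c))

  factor-spec : ∀ a c q → Simple n (factor a c q) × DL≡ n (factor a c q) (e a) × DR⊇ n (factor a c q) (e c)
  factor-spec a c = proj₁ (proj₂ (A-counts (e a) (e c)))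

  EndsIn : ∀ d → List ℕ → Vec (List ℕ) d → Set
  EndsIn d y xs = VAll.All (Simple n) xs × NormalSeq n (toList xs ∷ʳ y)

  EndsIn-last : ∀ {d y} xs → EndsIn (suc d) y xs → Simple n (Vec.last xs) × NormalPair n (Vec.last xs) y
  EndsIn-last xs (simple , normal) with Vec.initLast xs
  ... | ys , x , refl = proj₂ (All-∷ʳ⁻ ys simple) ,
    proj₂ (NormalSeq-∷ʳ⁻ (toList ys) x _ (≡.subst (λ l → NormalSeq n (l ∷ʳ _)) (Vec.toList-∷ʳ x ys) normal))

  appendLast : ∀ {d x y k} → Simple n x → NormalPair n x y → IsB n (suc d) x k →
    HasCount (Pointwise _≈_) (λ xs → EndsIn (suc d) y xs × Vec.last xs ≈ x) k
  appendLast {d} {x} {y} {k} simple-x xy (E , E-ends , E-injective , E-surjective) =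
    enum , enum-spec , enum-injective , enum-surjective
    where
    enum : Fin k → Vec (List ℕ) (suc d)
    enum i = E i Vec.∷ʳ x
    enum-spec : ∀ i → EndsIn (suc d) y (enum i) × Vec.last (enum i) ≈ x
    enum-spec i = (All-∷ʳ⁺ (proj₁ (E-ends i)) simple-x ,
      ≡.subst (λ l → NormalSeq n (l ∷ʳ y)) (≡.sym (Vec.toList-∷ʳ x (E i)))
        (NormalSeq-∷ʳ⁺ (toList (E i)) x y (proj₂ (E-ends i)) xy)) ,
      ≡.subst (_≈ x) (≡.sym (Vec.last-∷ʳ x (E i))) ε
    enum-injective : ∀ i j → Pointwise _≈_ (enum i) (enum j) → i ≡ j
    enum-injective i j Ei≈Ej = E-injective i j (proj₁ (Pointwise-∷ʳ⁻ (E i) (E j) Ei≈Ej))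
    enum-surjective : ∀ xs → EndsIn (suc d) y xs × Vec.last xs ≈ x → ∃ λ i → Pointwise _≈_ xs (enum i)
    enum-surjective xs ((simple , normal) , last≈x) with Vec.initLast xs
    ... | ys , x′ , refl = let
        ys-simple , _ = All-∷ʳ⁻ ys simple
        ys-normal = proj₁ (NormalSeq-∷ʳ⁻ (toList ys) x′ y
          (≡.subst (λ l → NormalSeq n (l ∷ʳ y)) (Vec.toList-∷ʳ x′ ys) normal))
        i , ys≈Ei = E-surjective ys (ys-simple , NormalSeq-resp-≈ (toList ys) ys-normal last≈x)
      in i , Pointwise-∷ʳ⁺ ys≈Ei last≈x

  normalSequences : ∀ d y c → Simple n y → DL≡ n y (e c) → IsB n (suc d) y (vecPow ones M′ d c)
  normalSequences zero    y c _ _ =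
    (λ _ → []) , (λ _ → VAll.[] , _) , (λ { zero zero _ → refl }) , λ { [] _ → zero , [] }
  normalSequences (suc d) y c simple-y DL-y =
    ≡.subst (HasCount (Pointwise _≈_) (EndsIn (suc d) y))
      (Σℕ-cong m λ a → ≡.trans (Σℕ-const (A (e a) (e c)) _) (ℕ.*-comm (A (e a) (e c)) _))
      (HasCount-Σ LastHasDL _ count-LastHasDL proj₁ ends⇒LastHasDL LastHasDL-disjoint)
    where
    LastHasDL : Fin m → Vec (List ℕ) (suc d) → Set
    LastHasDL a xs = EndsIn (suc d) y xs × DL≡ n (Vec.last xs) (e a)

    LastIsFactor : ∀ a → Fin (A (e a) (e c)) → Vec (List ℕ) (suc d) → Set
    LastIsFactor a q xs = EndsIn (suc d) y xs × Vec.last xs ≈ factor a c q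

    count-LastIsFactor : ∀ a q → HasCount (Pointwise _≈_) (LastIsFactor a q) (vecPow ones M′ d a)
    count-LastIsFactor a q = let simple , DL , DR = factor-spec a c q in
      appendLast simple (DR⊇⇒NormalPair DR DL-y) (normalSequences d (factor a c q) a simple DL)

    LastHasDL⇒LastIsFactor : ∀ {a xs} → LastHasDL a xs → ∃ λ q → LastIsFactor a q xs
    LastHasDL⇒LastIsFactor {a} {xs} (ends , DL) = let
        simple , last-y = EndsIn-last xs ends
        q , last≈ = proj₂ (proj₂ (proj₂ (A-counts (e a) (e c)))) _ (simple , DL , NormalPair⇒DR⊇ last-y DL-y)
      in q , ends , last≈

    count-LastHasDL : ∀ a → HasCount (Pointwise _≈_) (LastHasDL a) (Σℕ (A (e a) (e c)) λ _ → vecPow ones M′ d a)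
    count-LastHasDL a = HasCount-Σ (LastIsFactor a) _ (count-LastIsFactor a)
      (λ {q} (ends , last≈) → ends , DL≡-resp-≈ (proj₁ (proj₂ (factor-spec a c q))) (≈-sym last≈))
      LastHasDL⇒LastIsFactor
      (λ {q} {q′} (_ , last≈) (_ , last≈′) xs≈xs′ → proj₁ (proj₂ (proj₂ (A-counts (e a) (e c)))) q q′
        (≈-trans (≈-sym last≈) (≈-trans (Pointwise-last xs≈xs′) last≈′)))

    ends⇒LastHasDL : ∀ {xs} → EndsIn (suc d) y xs → ∃ λ a → LastHasDL a xs
    ends⇒LastHasDL {xs} ends = let wx = proj₁ (proj₁ (EndsIn-last xs ends)) in
      index (leftDescents wx) , ends , ≡.subst (DL≡ n (Vec.last xs)) (≡.sym (e-index _)) (leftDescents-DL≡ wx)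

    LastHasDL-disjoint : ∀ {a b xs xs′} → LastHasDL a xs → LastHasDL b xs′ → Pointwise _≈_ xs xs′ → a ≡ b
    LastHasDL-disjoint (_ , DLa) (_ , DLb) xs≈xs′ = e-injective (DL≡-unique (DL≡-resp-≈ DLa (Pointwise-last xs≈xs′)) DLb)

  _≟ˢ_ : (I J : Subset (n ∸ 1)) → Dec (I ≡ J)
  _≟ˢ_ = Vec.≡-dec Bool._≟_

  module Factorisation (N : ℕ) (enum : HasCount _≈_ (Simple n) N) (Mn : Fin N → Fin N → ℕ)
    (Mn-normal : ∀ a b → (NormalPair n (proj₁ enum a) (proj₁ enum b) → Mn a b ≡ 1)
                        × (¬ NormalPair n (proj₁ enum a) (proj₁ enum b) → Mn a b ≡ 0)) where

    simpleBraid : Fin N → List ℕ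
    simpleBraid = proj₁ enum

    simpleBraid-isSimple : ∀ y → Simple n (simpleBraid y)
    simpleBraid-isSimple = proj₁ (proj₂ enum)

    simpleBraid-isWord : ∀ y → IsWord n (simpleBraid y)
    simpleBraid-isWord y = proj₁ (simpleBraid-isSimple y)

    DLᵇ : Fin N → Subset (n ∸ 1)
    DLᵇ y = leftDescents (simpleBraid-isWord y)

    U : Fin N → Fin m → ℕ
    U x J = 𝟙 (DR⊇? (simpleBraid-isWord x) (e J))

    V : Fin m → Fin N → ℕ
    V J y = 𝟙 (e J ≟ˢ DLᵇ y)

    Mn≡UV : ∀ x y → Mn x y ≡ Σℕ m (λ J → U x J ℕ.* V J y)
    Mn≡UV x y = ≡.sym (begin
      Σℕ m (λ J → U x J ℕ.* V J y)
        ≡⟨ Σℕ-single m _ J₀ (λ J J≢J₀ →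
             ≡.trans (≡.cong (U x J ℕ.*_) (V-other J J≢J₀ (e J ≟ˢ DLᵇ y))) (ℕ.*-zeroʳ (U x J))) ⟩
      U x J₀ ℕ.* V J₀ y  ≡⟨ ≡.cong (U x J₀ ℕ.*_) (V-index (e J₀ ≟ˢ DLᵇ y)) ⟩
      U x J₀ ℕ.* 1       ≡⟨ ℕ.*-identityʳ _ ⟩
      U x J₀             ≡⟨ U-normal (DR⊇? (simpleBraid-isWord x) (e J₀)) ⟩
      Mn x y             ∎)
      where
      open ≡.≡-Reasoning
      J₀ : Fin m
      J₀ = index (DLᵇ y)
      V-index : (d : Dec (e J₀ ≡ DLᵇ y)) → 𝟙 d ≡ 1
      V-index (yes _)  = refl
      V-index (no J₀≢) = contradiction (e-index _) J₀≢
      V-other : ∀ J → J ≢ J₀ → (d : Dec (e J ≡ DLᵇ y)) → 𝟙 d ≡ 0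
      V-other J J≢J₀ (yes eJ≡) = contradiction (e-injective (≡.trans eJ≡ (≡.sym (e-index _)))) J≢J₀
      V-other J J≢J₀ (no _)    = refl
      DL-y : DL≡ n (simpleBraid y) (e J₀)
      DL-y = ≡.subst (DL≡ n (simpleBraid y)) (≡.sym (e-index _)) (leftDescents-DL≡ _)
      U-normal : (d : Dec (DR⊇ n (simpleBraid x) (e J₀))) → 𝟙 d ≡ Mn x y
      U-normal (yes DR) = ≡.sym (proj₁ (Mn-normal x y) (DR⊇⇒NormalPair DR DL-y))
      U-normal (no ¬DR) = ≡.sym (proj₂ (Mn-normal x y) λ xy → ¬DR (NormalPair⇒DR⊇ xy DL-y))

    M′≡VU : ∀ J I → M′ J I ≡ Σℕ N (λ y → V J y ℕ.* U y I)
    M′≡VU J I = HasCount-unique ≈-sym ≈-trans (A-counts (e J) (e I)) (≡.subst (HasCount _≈_ _)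
      (Σℕ-cong N λ y → ≡.sym (𝟙-× (e J ≟ˢ DLᵇ y) (DR⊇? (simpleBraid-isWord y) (e I)))) counted)
      where
      Condition : Fin N → Set
      Condition y = e J ≡ DLᵇ y × DR⊇ n (simpleBraid y) (e I)
      Q : Fin N → List ℕ → Set
      Q y x = x ≈ simpleBraid y × Condition y
      counted : HasCount _≈_ (λ x → Simple n x × DL≡ n x (e J) × DR⊇ n x (e I)) _
      counted = HasCount-Σ Q _
        (λ y → HasCount-indicator {_∼_ = _≈_} ε ((e J ≟ˢ DLᵇ y) ×-dec DR⊇? (simpleBraid-isWord y) (e I)))
        (λ {y} (x≈y , eJ≡ , DR) → Simple-resp-≈ (simpleBraid-isSimple y) (≈-sym x≈y) ,
          DL≡-resp-≈ (≡.subst (DL≡ n (simpleBraid y)) (≡.sym eJ≡) (leftDescents-DL≡ (simpleBraid-isWord y))) (≈-sym x≈y) ,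
          DR⊇-resp-≈ DR (≈-sym x≈y))
        (λ {x} (simple , DL , DR) → let y , x≈y = proj₂ (proj₂ (proj₂ enum)) x simple in
          y , x≈y , DL≡-unique (DL≡-resp-≈ DL x≈y) (leftDescents-DL≡ (simpleBraid-isWord y)) , DR⊇-resp-≈ DR x≈y)
        (λ {y} {y′} (x≈y , _) (x′≈y′ , _) x≈x′ →
          proj₁ (proj₂ (proj₂ enum)) y y′ (≈-trans (≈-sym x≈y) (≈-trans x≈x′ x′≈y′)))

lemma2p12 :
    (n : ℕ) → n ≥ 1 →
    -- M'_n : indices Fin m ordered by a bijection e onto subsets of {1,…,n-1}
    (m : ℕ) (e : Fin m → Subset (n ∸ 1)) → Bijective _≡_ _≡_ e →
    (A : Subset (n ∸ 1) → Subset (n ∸ 1) → ℕ) →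
    (∀ I J → IsA n I J (A I J)) →
    -- M_n : indices Fin N enumerating the simple n-braids
    (N : ℕ) (enum : HasCount _≈_ (Simple n) N) →
    (Mn : Fin N → Fin N → ℕ) →
    (∀ a b → (NormalPair n (proj₁ enum a) (proj₁ enum b) → Mn a b ≡ 1)
           × (¬ NormalPair n (proj₁ enum a) (proj₁ enum b) → Mn a b ≡ 0)) →
    (Σ ℕ λ k →
        (charPoly N Mn ≋ ((Xₚ ^ₚ k) *ₚ charPoly m (λ a b → A (e a) (e b))))
      ⊎ (charPoly m (λ a b → A (e a) (e b)) ≋ ((Xₚ ^ₚ k) *ₚ charPoly N Mn)))
    ×
    (∀ (y : List ℕ) (J : Subset (n ∸ 1)) → Simple n y → DL≡ n y J →
       ∀ (d : ℕ) → d ≥ 1 → ∀ (c : Fin m) → e c ≡ J →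
       IsB n d y (vecPow ones (λ a b → A (e a) (e b)) (d ∸ 1) c))
lemma2p12 n _ m e e-bijective A A-counts N enum Mn Mn-normal =
  IntegerPolynomials.charPoly-factorisation N m Mn M′ U V Mn≡UV M′≡VU ,
  λ { y J simple-y DL-y (suc d) _ c refl → normalSequences d y c simple-y DL-y }
  where
  open NormalFormCounting n m e e-bijective A A-counts
  open Factorisation N enum Mn Mn-normal
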